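{- Let $a$ be one of $\mathsf{m}$, $\mathrm{ems}$, $\mathrm{ess}$, $\mathrm{ms}\neg\multimap$, $\mathrm{ss}\neg\multimap$. Then the relation $\to_a$ is strongly normalizing on all (untyped) terms of the exponential substitution calculus, i.e. there is no infinite $\to_a$-reduction sequence starting from any term.
   Context: Exponential substitution calculus (ESC). Variables come in two disjoint countably infinite kinds: multiplicative variables $m,n,o,\ldots$ and exponential variables $e,f,g,\ldots$; $x,y,z$ denote variables of either kind. Multiplicative values $v_{\mathsf m} ::= m \mid (t,s) \mid \lambda x.t$; exponential values $v_{\mathsf e} ::= e \mid\ !t$; values $v ::= v_{\mathsf m}\mid v_{\mathsf e}$. Terms: $t,s,u ::= v \mid \mathsf{cut}(v,x.t) \mid \mathsf{par}(m,x.y.t) \mid \mathsf{sub}(m,v,x.t) \mid \mathsf{der}(e,x.t)$ (cut, par, subtraction, dereliction; note the first argument of cut and the second of subtraction must be values). In $\lambda x.t$, $\mathsf{cut}(v,x.t)$, $\mathsf{sub}(m,v,x.t)$, $\mathsf{der}(e,x.t)$ the variable $x$ is bound in $t$; in $\mathsf{par}(m,x.y.t)$ both $x,y$ are bound in $t$; terms are identified up to $\alpha$-renaming; $\mathrm{fv}(t)$ denotes free variables. Left contexts: $L ::= \langle\cdot\rangle \mid \mathsf{cut}(v,x.L)\mid\mathsf{par}(m,x.y.L)\mid\mathsf{sub}(m,v,x.L)\mid\mathsf{der}(e,x.L)$; every term $t$ is uniquely $t=L\langle v\rangle$. Value contexts $V ::= \langle\cdot\rangle \mid (C,s)\mid (t,C)\mid\lambda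 x.C\mid\ !C$; general contexts $C ::= V \mid \mathsf{cut}(V,x.t)\mid\mathsf{sub}(m,V,x.t)\mid L\langle C\rangle$; multiplicative value contexts $V_{\mathsf m} ::= \langle\cdot\rangle\mid (M,s)\mid(t,M)\mid\lambda x.M$; multiplicative contexts $M ::= V_{\mathsf m}\mid \mathsf{cut}(V_{\mathsf m},x.t)\mid \mathsf{sub}(m,V_{\mathsf m},x.t)\mid L\langle M\rangle$ (hole not under any $!$). Plugging $C\langle t\rangle$ replaces the hole by $t$ (possibly capturing variables), except that when the hole is directly the value of a cut or subtraction, the left context is extracted: if $t=L\langle v\rangle$ then $\mathsf{cut}(\langle\cdot\rangle,x.s)\langle t\rangle := L\langle\mathsf{cut}(v,x.s)\rangle$ and $\mathsf{sub}(m,\langle\cdot\rangle,x.s)\langle t\rangle := L\langle\mathsf{sub}(m,v,x.s)\rangle$. $C\langle\!\langle t\rangle\!\rangle$ is plugging with renaming of bound variables of $C$ so that no free variable of $t$ is captured. Meta-level substitution $\{v_{\mathsf e}/e\}t$ (capture-avoiding) commutes with all constructors, is the identity on variables other than $e$, sets $\{v_{\mathsf e}/e\}e := v_{\mathsf e}$, and on derelictions on $e$: $\{f/e\}\mathsf{der}(e,x.t) := \mathsf{der}(f,x.\{f/e\}t)$ and $\{!L\langle v\rangle/e\}\mathsf{der}(e,x.t) := L\langle \mathsf{cut}(v,x.\{!L\langle v\rangle/e\}t)\rangle$. For multiplicative $m,n$, $\{n/m\}t$ is renaming. Root rules (the context $M$ or $C$ does not capture the cut variable $m$ or $e$): (ax$_{m1}$)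 $\mathsf{cut}(v_{\mathsf m},m.M\langle\!\langle m\rangle\!\rangle)\mapsto M\langle\!\langle v_{\mathsf m}\rangle\!\rangle$; (ax$_{m2}$) $\mathsf{cut}(n,m.t)\mapsto \{n/m\}t$; ($\otimes$) $\mathsf{cut}((s,u),m.M\langle\mathsf{par}(m,x.y.t)\rangle)\mapsto M\langle L\langle\mathsf{cut}(v,x.L'\langle\mathsf{cut}(v',y.t)\rangle)\rangle\rangle$ where $s=L\langle v\rangle$, $u=L'\langle v'\rangle$; ($\multimap$) $\mathsf{cut}(\lambda y.s,m.M\langle\mathsf{sub}(m,v,x.t)\rangle)\mapsto M\langle\mathsf{cut}(v,y.L\langle\mathsf{cut}(v',x.t)\rangle)\rangle$ where $s=L\langle v'\rangle$; (ax$_{e1}$) $\mathsf{cut}(v_{\mathsf e},e.C\langle\!\langle e\rangle\!\rangle)\mapsto\mathsf{cut}(v_{\mathsf e},e.C\langle\!\langle v_{\mathsf e}\rangle\!\rangle)$; (ax$_{e2}$) $\mathsf{cut}(f,e.C\langle\mathsf{der}(e,x.t)\rangle)\mapsto\mathsf{cut}(f,e.C\langle\mathsf{der}(f,x.t)\rangle)$; (!der) $\mathsf{cut}(!s,e.C\langle\mathsf{der}(e,x.t)\rangle)\mapsto\mathsf{cut}(!s,e.C\langle L\langle\mathsf{cut}(v,x.t)\rangle\rangle)$ where $s=L\langle v\rangle$; (w) $\mathsf{cut}(v_{\mathsf e},e.t)\mapsto t$ if $e\notin\mathrm{fv}(t)$; (ess) $\mathsf{cut}(v_{\mathsf e},e.t)\mapsto\{v_{\mathsf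 e}/e\}t$. Each root rule $\mapsto_a$ induces $\to_a$ by closure under general contexts. Notations: $\to_{\mathsf m}:=\to_{ax_{m1}}\cup\to_{ax_{m2}}\cup\to_\otimes\cup\to_\multimap$; $\to_{\mathrm{ems}} := \to_{ax_{e1}}\cup\to_{ax_{e2}}\cup\to_{!der}\cup\to_w$; $\to_{\mathrm{ss}}:=\to_{\mathsf m}\cup\to_{\mathrm{ess}}$; $\to_{\mathrm{ms}}:=\to_{\mathsf m}\cup\to_{\mathrm{ems}}$; $\to_{\mathrm{ms}\neg\multimap}:=\to_{ax_{m1}}\cup\to_{ax_{m2}}\cup\to_\otimes\cup\to_{\mathrm{ems}}$; $\to_{\mathrm{ss}\neg\multimap}:=\to_{ax_{m1}}\cup\to_{ax_{m2}}\cup\to_\otimes\cup\to_{\mathrm{ess}}$. -}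

module Defs where

-- A scope lists the kinds of the variables in scope, innermost binder first.

open import Data.Nat using (ℕ; zero; suc)
open import Data.List using (List; []; _∷_; _++_)
open import Data.List.Membership.Propositional using (_∈_)
open import Data.Product using (Σ; Σ-syntax; _×_; _,_)
open import Relation.Binary.PropositionalEquality using (_≡_)
open import Relation.Nullary using (¬_)

data Kind : Set where
  mul exp : Kind

Scope : Set
Scope = List Kind

infix 4 _∋_
data _∋_ : Scope → Kind → Set where
  vz : ∀ {Γ k} → (k ∷ Γ) ∋ k
  vs : ∀ {Γ k k'} → Γ ∋ k → (k' ∷ Γ) ∋ k

-- Θ ⧺ Γ : extend Γ by the telescope Θ (listed outermost first).
_⧺_ : Scope → Scope → Scope
[] ⧺ Γ = Γ
(k ∷ Θ) ⧺ Γ = Θ ⧺ (k ∷ Γ)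

-- Syntax
-- values  v ::= m | (t,s) | λx.t | e | !t
-- terms   t ::= v | cut(v,x.t) | par(m,x.y.t) | sub(m,v,x.t) | der(e,x.t)
-- The Kind arguments of binders give the kind of the bound variable x (and y).

mutual
  data Val (Γ : Scope) : Kind → Set where
    var  : ∀ {k} → Γ ∋ k → Val Γ k
    pair : Tm Γ → Tm Γ → Val Γ mul
    lam  : (k : Kind) → Tm (k ∷ Γ) → Val Γ mul
    bang : Tm Γ → Val Γ exp

  data Tm (Γ : Scope) : Set where
    val : ∀ {k} → Val Γ k → Tm Γ
    cut : ∀ {k} → Val Γ k → (k' : Kind) → Tm (k' ∷ Γ) → Tm Γ
    par : Γ ∋ mul → (k₁ k₂ : Kind) → Tm (k₂ ∷ k₁ ∷ Γ) → Tm Γ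
    sub : ∀ {k} → Γ ∋ mul → Val Γ k → (k' : Kind) → Tm (k' ∷ Γ) → Tm Γ
    der : Γ ∋ exp → (k' : Kind) → Tm (k' ∷ Γ) → Tm Γ

Ren : Scope → Scope → Set
Ren Γ Δ = ∀ {k} → Γ ∋ k → Δ ∋ k

lift : ∀ {Γ Δ k} → Ren Γ Δ → Ren (k ∷ Γ) (k ∷ Δ)
lift ρ vz = vz
lift ρ (vs x) = vs (ρ x)

liftR : ∀ {Γ Δ} Θ → Ren Γ Δ → Ren (Θ ⧺ Γ) (Θ ⧺ Δ)
liftR [] ρ x = ρ x
liftR (k ∷ Θ) ρ x = liftR Θ (lift ρ) x

wkΘ : ∀ {Γ} Θ → Ren Γ (Θ ⧺ Γ)
wkΘ [] x = x
wkΘ (k ∷ Θ) x = wkΘ Θ (vs x)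

single : ∀ {Γ k} → Γ ∋ k → Ren (k ∷ Γ) Γ
single n vz = n
single n (vs x) = x

mutual
  renV : ∀ {Γ Δ k} → Ren Γ Δ → Val Γ k → Val Δ k
  renV ρ (var x) = var (ρ x)
  renV ρ (pair t s) = pair (renT ρ t) (renT ρ s)
  renV ρ (lam k t) = lam k (renT (lift ρ) t)
  renV ρ (bang t) = bang (renT ρ t)

  renT : ∀ {Γ Δ} → Ren Γ Δ → Tm Γ → Tm Δ
  renT ρ (val v) = val (renV ρ v)
  renT ρ (cut v k t) = cut (renV ρ v) k (renT (lift ρ) t)
  renT ρ (par m k₁ k₂ t) = par (ρ m) k₁ k₂ (renT (lift (lift ρ)) t)
  renT ρ (sub m v k t) = sub (ρ m) (renV ρ v) k (renT (lift ρ) t)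
  renT ρ (der e k t) = der (ρ e) k (renT (lift ρ) t)

-- Left contexts  L ::= <.> | cut(v,x.L) | par(m,x.y.L) | sub(m,v,x.L) | der(e,x.L)
-- LCtx Γ Λ : outer scope Γ, scope at the hole Λ.

data LCtx (Γ : Scope) : Scope → Set where
  ∙    : LCtx Γ Γ
  cutL : ∀ {k Λ} → Val Γ k → (k' : Kind) → LCtx (k' ∷ Γ) Λ → LCtx Γ Λ
  parL : ∀ {Λ} → Γ ∋ mul → (k₁ k₂ : Kind) → LCtx (k₂ ∷ k₁ ∷ Γ) Λ → LCtx Γ Λ
  subL : ∀ {k Λ} → Γ ∋ mul → Val Γ k → (k' : Kind) → LCtx (k' ∷ Γ) Λ → LCtx Γ Λ
  derL : ∀ {Λ} → Γ ∋ exp → (k' : Kind) → LCtx (k' ∷ Γ) Λ → LCtx Γ Λ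

plugL : ∀ {Γ Λ} → LCtx Γ Λ → Tm Λ → Tm Γ
plugL ∙ u = u
plugL (cutL v k L) u = cut v k (plugL L u)
plugL (parL m k₁ k₂ L) u = par m k₁ k₂ (plugL L u)
plugL (subL m v k L) u = sub m v k (plugL L u)
plugL (derL e k L) u = der e k (plugL L u)

lwk : ∀ {Γ Λ} → LCtx Γ Λ → Ren Γ Λ
lwk ∙ x = x
lwk (cutL v k L) x = lwk L (vs x)
lwk (parL m k₁ k₂ L) x = lwk L (vs (vs x))
lwk (subL m v k L) x = lwk L (vs x)
lwk (derL e k L) x = lwk L (vs x)

record Decomp (Γ : Scope) : Set where
  constructor ⟨_,_⟩
  field
    {hscope} : Scope
    {vkind}  : Kind
    lctx     : LCtx Γ hscope
    value    : Val hscope vkind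

decomp : ∀ {Γ} → Tm Γ → Decomp Γ
decomp (val v) = ⟨ ∙ , v ⟩
decomp (cut v k t) with decomp t
... | ⟨ L , w ⟩ = ⟨ cutL v k L , w ⟩
decomp (par m k₁ k₂ t) with decomp t
... | ⟨ L , w ⟩ = ⟨ parL m k₁ k₂ L , w ⟩
decomp (sub m v k t) with decomp t
... | ⟨ L , w ⟩ = ⟨ subL m v k L , w ⟩
decomp (der e k t) with decomp t
... | ⟨ L , w ⟩ = ⟨ derL e k L , w ⟩

-- cutUnder (L<v>) x t  =  L<cut(v, x.t)>   (t not captured by L)
cutUnder : ∀ {Γ} → Decomp Γ → (k : Kind) → Tm (k ∷ Γ) → Tm Γ
cutUnder ⟨ L , v ⟩ k t = plugL L (cut v k (renT (lift (lwk L)) t))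

subUnder : ∀ {Γ} → Γ ∋ mul → Decomp Γ → (k : Kind) → Tm (k ∷ Γ) → Tm Γ
subUnder m ⟨ L , v ⟩ k t = plugL L (sub (lwk L m) v k (renT (lift (lwk L)) t))

-- Index CK: gen = general contexts C, mulc = multiplicative
-- contexts M (hole not under any !).  Ctx c Γ Θ has outer scope Γ and
-- scope Θ ⧺ Γ at the hole.
--  V ::= (C,s) | (t,C) | λx.C | !C        (non-empty value contexts, VCtx)
--  C ::= <.> | V | cut(<.>,x.t) | cut(V,x.t) | sub(m,<.>,x.t) | sub(m,V,x.t)
--      | cut(v,x.C) | par(m,x.y.C) | sub(m,v,x.C) | der(e,x.C)   (= L<C>)

data CK : Set where
  gen mulc : CK

mutual
  data VCtx : CK → Scope → Scope → Kind → Set where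
    pairL : ∀ {c Γ Θ} → Ctx c Γ Θ → Tm Γ → VCtx c Γ Θ mul
    pairR : ∀ {c Γ Θ} → Tm Γ → Ctx c Γ Θ → VCtx c Γ Θ mul
    lamC  : ∀ {c Γ Θ} (k : Kind) → Ctx c (k ∷ Γ) Θ → VCtx c Γ (k ∷ Θ) mul
    bangC : ∀ {Γ Θ} → Ctx gen Γ Θ → VCtx gen Γ Θ exp

  data Ctx : CK → Scope → Scope → Set where
    hole : ∀ {c Γ} → Ctx c Γ []
    valC : ∀ {c Γ Θ k} → VCtx c Γ Θ k → Ctx c Γ Θ
    cutH : ∀ {c Γ} (k' : Kind) → Tm (k' ∷ Γ) → Ctx c Γ []
    cutV : ∀ {c Γ Θ k} → VCtx c Γ Θ k → (k' : Kind) → Tm (k' ∷ Γ) → Ctx c Γ Θ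
    subH : ∀ {c Γ} → Γ ∋ mul → (k' : Kind) → Tm (k' ∷ Γ) → Ctx c Γ []
    subV : ∀ {c Γ Θ k} → Γ ∋ mul → VCtx c Γ Θ k → (k' : Kind) → Tm (k' ∷ Γ) → Ctx c Γ Θ
    cutB : ∀ {c Γ Θ k} → Val Γ k → (k' : Kind) → Ctx c (k' ∷ Γ) Θ → Ctx c Γ (k' ∷ Θ)
    parB : ∀ {c Γ Θ} → Γ ∋ mul → (k₁ k₂ : Kind) → Ctx c (k₂ ∷ k₁ ∷ Γ) Θ → Ctx c Γ (k₁ ∷ k₂ ∷ Θ)
    subB : ∀ {c Γ Θ k} → Γ ∋ mul → Val Γ k → (k' : Kind) → Ctx c (k' ∷ Γ) Θ → Ctx c Γ (k' ∷ Θ)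
    derB : ∀ {c Γ Θ} → Γ ∋ exp → (k' : Kind) → Ctx c (k' ∷ Γ) Θ → Ctx c Γ (k' ∷ Θ)

-- plugging (capturing), with left-context extraction at value holes of cut/sub
mutual
  plugV : ∀ {c Γ Θ k} → VCtx c Γ Θ k → Tm (Θ ⧺ Γ) → Val Γ k
  plugV (pairL C s) u = pair (plug C u) s
  plugV (pairR s C) u = pair s (plug C u)
  plugV (lamC k C) u = lam k (plug C u)
  plugV (bangC C) u = bang (plug C u)

  plug : ∀ {c Γ Θ} → Ctx c Γ Θ → Tm (Θ ⧺ Γ) → Tm Γ
  plug hole u = u
  plug (valC V) u = val (plugV V u)
  plug (cutH k s) u = cutUnder (decomp u) k s
  plug (cutV V k s) u = cut (plugV V u) k s
  plug (subH m k s) u = subUnder m (decomp u) k s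
  plug (subV m V k s) u = sub m (plugV V u) k s
  plug (cutB v k C) u = cut v k (plug C u)
  plug (parB m k₁ k₂ C) u = par m k₁ k₂ (plug C u)
  plug (subB m v k C) u = sub m v k (plug C u)
  plug (derB e k C) u = der e k (plug C u)

mutual
  renVC : ∀ {c Γ Δ Θ k} → Ren Γ Δ → VCtx c Γ Θ k → VCtx c Δ Θ k
  renVC ρ (pairL C s) = pairL (renC ρ C) (renT ρ s)
  renVC ρ (pairR s C) = pairR (renT ρ s) (renC ρ C)
  renVC ρ (lamC k C) = lamC k (renC (lift ρ) C)
  renVC ρ (bangC C) = bangC (renC ρ C)

  renC : ∀ {c Γ Δ Θ} → Ren Γ Δ → Ctx c Γ Θ → Ctx c Δ Θ
  renC ρ hole = hole
  renC ρ (valC V) = valC (renVC ρ V)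
  renC ρ (cutH k s) = cutH k (renT (lift ρ) s)
  renC ρ (cutV V k s) = cutV (renVC ρ V) k (renT (lift ρ) s)
  renC ρ (subH m k s) = subH (ρ m) k (renT (lift ρ) s)
  renC ρ (subV m V k s) = subV (ρ m) (renVC ρ V) k (renT (lift ρ) s)
  renC ρ (cutB v k C) = cutB (renV ρ v) k (renC (lift ρ) C)
  renC ρ (parB m k₁ k₂ C) = parB (ρ m) k₁ k₂ (renC (lift (lift ρ)) C)
  renC ρ (subB m v k C) = subB (ρ m) (renV ρ v) k (renC (lift ρ) C)
  renC ρ (derB e k C) = derB (ρ e) k (renC (lift ρ) C)

-- Meta-level substitution of exponential values for exponential variables
-- (multiplicative variables are only renamed).

Img : Scope → Kind → Set
Img Δ mul = Δ ∋ mul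
Img Δ exp = Val Δ exp

ESub : Scope → Scope → Set
ESub Γ Δ = ∀ {k} → Γ ∋ k → Img Δ k

varImg : ∀ {Δ k} → Δ ∋ k → Img Δ k
varImg {k = mul} x = x
varImg {k = exp} x = var x

imgVal : ∀ {Δ k} → Img Δ k → Val Δ k
imgVal {k = mul} x = var x
imgVal {k = exp} v = v

renImg : ∀ {Δ Δ' k} → Ren Δ Δ' → Img Δ k → Img Δ' k
renImg {k = mul} ρ x = ρ x
renImg {k = exp} ρ v = renV ρ v

liftS : ∀ {Γ Δ k} → ESub Γ Δ → ESub (k ∷ Γ) (k ∷ Δ)
liftS σ vz = varImg vz
liftS σ (vs x) = renImg vs (σ x)

mutual
  substV : ∀ {Γ Δ k} → ESub Γ Δ → Val Γ k → Val Δ k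
  substV σ (var x) = imgVal (σ x)
  substV σ (pair t s) = pair (substT σ t) (substT σ s)
  substV σ (lam k t) = lam k (substT (liftS σ) t)
  substV σ (bang t) = bang (substT σ t)

  substT : ∀ {Γ Δ} → ESub Γ Δ → Tm Γ → Tm Δ
  substT σ (val v) = val (substV σ v)
  substT σ (cut v k t) = cut (substV σ v) k (substT (liftS σ) t)
  substT σ (par m k₁ k₂ t) = par (σ m) k₁ k₂ (substT (liftS (liftS σ)) t)
  substT σ (sub m v k t) = sub (σ m) (substV σ v) k (substT (liftS σ) t)
  substT σ (der e k t) with σ e
  ... | var f = der f k (substT (liftS σ) t)
  ... | bang s with decomp s
  ... | ⟨ L , v ⟩ = plugL L (cut v k (substT (liftS (λ x → renImg (lwk L) (σ x))) t))

essSub : ∀ {Γ} → Val Γ exp → ESub (exp ∷ Γ) Γ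
essSub v vz = v
essSub v (vs x) = varImg x

-- In the named calculus the rules
-- (ax_m1), (⊗), (⊸) remove the binder m of the cut without substituting for
-- the remaining occurrences of m (if any) in M (and t, v); these become a
-- fresh free variable.  We model this by inserting a fresh multiplicative
-- variable at an arbitrary position of the (free) outer scope.

data Ins : Scope → Scope → Set where
  here  : ∀ {Γ} → Ins Γ (mul ∷ Γ)
  there : ∀ {Γ Δ k} → Ins Γ Δ → Ins (k ∷ Γ) (k ∷ Δ)

insShift : ∀ {Γ Δ} → Ins Γ Δ → Ren Γ Δ
insShift here x = vs x
insShift (there g) vz = vz
insShift (there g) (vs x) = vs (insShift g x)

insVar : ∀ {Γ Δ} → Ins Γ Δ → Δ ∋ mul
insVar here = vz
insVar (there g) = vs (insVar g)

escape : ∀ {Γ Δ} → Ins Γ Δ → Ren (mul ∷ Γ) Δ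
escape g vz = insVar g
escape g (vs x) = insShift g x

liftIns : ∀ {Γ Δ} Θ → Ins Γ Δ → Ins (Θ ⧺ Γ) (Θ ⧺ Δ)
liftIns [] g = g
liftIns (k ∷ Θ) g = liftIns Θ (there g)

data Grow : Scope → Scope → Set where
  same : ∀ {Γ} → Grow Γ Γ
  grow : ∀ {Γ Δ} → Ins Γ Δ → Grow Γ Δ

liftGrow : ∀ {Γ Δ} Θ → Grow Γ Δ → Grow (Θ ⧺ Γ) (Θ ⧺ Δ)
liftGrow Θ same = same
liftGrow Θ (grow g) = grow (liftIns Θ g)

growRen : ∀ {Γ Δ} → Grow Γ Δ → Ren Γ Δ
growRen same x = x
growRen (grow g) x = insShift g x

data Rule : Set where
  ax-m1 ax-m2 ⊗-rule ⊸-rule ax-e1 ax-e2 bang-der weak ess : Rule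

data Root : Rule → ∀ {Γ Δ} → Grow Γ Δ → Tm Γ → Tm Δ → Set where
  -- cut(v_m, m. M<<m>>) ↦ M<<v_m>>
  r-ax-m1 : ∀ {Γ Δ Θ} (v : Val Γ mul) (M : Ctx mulc (mul ∷ Γ) Θ) (g : Ins Γ Δ) →
    Root ax-m1 (grow g)
      (cut v mul (plug M (val (var (wkΘ Θ vz)))))
      (plug (renC (escape g) M) (val (renV (wkΘ Θ) (renV (insShift g) v))))
  r-ax-m2 : ∀ {Γ} (n : Γ ∋ mul) (t : Tm (mul ∷ Γ)) →
    Root ax-m2 same (cut (var n) mul t) (renT (single n) t)
  -- cut((s,u), m.M<par(m,x.y.t)>) ↦ M<L<cut(v, x.L'<cut(v', y.t)>)>>
  r-⊗ : ∀ {Γ Δ Θ} (s u : Tm Γ) (M : Ctx mulc (mul ∷ Γ) Θ) (k₁ k₂ : Kind)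
    (t : Tm (k₂ ∷ k₁ ∷ (Θ ⧺ (mul ∷ Γ)))) (g : Ins Γ Δ) →
    Root ⊗-rule (grow g)
      (cut (pair s u) mul (plug M (par (wkΘ Θ vz) k₁ k₂ t)))
      (plug (renC (escape g) M)
        (cutUnder (decomp (renT (wkΘ Θ) (renT (insShift g) s))) k₁
          (cutUnder (decomp (renT vs (renT (wkΘ Θ) (renT (insShift g) u)))) k₂
            (renT (lift (lift (liftR Θ (escape g)))) t))))
  -- cut(λy.s, m.M<sub(m,v,x.t)>) ↦ M<cut(v, y.L<cut(v', x.t)>)>
  r-⊸ : ∀ {Γ Δ Θ k kᵥ} (s : Tm (k ∷ Γ)) (M : Ctx mulc (mul ∷ Γ) Θ)
    (v : Val (Θ ⧺ (mul ∷ Γ)) kᵥ) (k' : Kind) (t : Tm (k' ∷ (Θ ⧺ (mul ∷ Γ)))) (g : Ins Γ Δ) →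
    Root ⊸-rule (grow g)
      (cut (lam k s) mul (plug M (sub (wkΘ Θ vz) v k' t)))
      (plug (renC (escape g) M)
        (cut (renV (liftR Θ (escape g)) v) k
          (cutUnder (decomp (renT (lift (wkΘ Θ)) (renT (lift (insShift g)) s))) k'
            (renT (lift (λ x → vs (liftR Θ (escape g) x))) t))))
  -- cut(v_e, e.C<<e>>) ↦ cut(v_e, e.C<<v_e>>)
  r-ax-e1 : ∀ {Γ Θ} (v : Val Γ exp) (C : Ctx gen (exp ∷ Γ) Θ) →
    Root ax-e1 same
      (cut v exp (plug C (val (var (wkΘ Θ vz)))))
      (cut v exp (plug C (val (renV (λ x → wkΘ Θ (vs x)) v))))
  -- cut(f, e.C<der(e,x.t)>) ↦ cut(f, e.C<der(f,x.t)>)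
  r-ax-e2 : ∀ {Γ Θ} (f : Γ ∋ exp) (C : Ctx gen (exp ∷ Γ) Θ) (k : Kind)
    (t : Tm (k ∷ (Θ ⧺ (exp ∷ Γ)))) →
    Root ax-e2 same
      (cut (var f) exp (plug C (der (wkΘ Θ vz) k t)))
      (cut (var f) exp (plug C (der (wkΘ Θ (vs f)) k t)))
  -- cut(!s, e.C<der(e,x.t)>) ↦ cut(!s, e.C<L<cut(v,x.t)>>)  where s = L<v>
  r-!der : ∀ {Γ Θ} (s : Tm Γ) (C : Ctx gen (exp ∷ Γ) Θ) (k : Kind)
    (t : Tm (k ∷ (Θ ⧺ (exp ∷ Γ)))) →
    Root bang-der same
      (cut (bang s) exp (plug C (der (wkΘ Θ vz) k t)))
      (cut (bang s) exp (plug C (cutUnder (decomp (renT (λ x → wkΘ Θ (vs x)) s)) k t)))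
  -- cut(v_e, e.t) ↦ t   if e ∉ fv(t)
  r-w : ∀ {Γ} (v : Val Γ exp) (t : Tm Γ) →
    Root weak same (cut v exp (renT vs t)) t
  r-ess : ∀ {Γ} (v : Val Γ exp) (t : Tm (exp ∷ Γ)) →
    Root ess same (cut v exp t) (substT (essSub v) t)

data System : Set where
  𝗆 ems ess-sys ss ms ms¬⊸ ss¬⊸ : System

rulesOf : System → List Rule
rulesOf 𝗆 = ax-m1 ∷ ax-m2 ∷ ⊗-rule ∷ ⊸-rule ∷ []
rulesOf ems = ax-e1 ∷ ax-e2 ∷ bang-der ∷ weak ∷ []
rulesOf ess-sys = ess ∷ []
rulesOf ss = ax-m1 ∷ ax-m2 ∷ ⊗-rule ∷ ⊸-rule ∷ ess ∷ []
rulesOf ms = ax-m1 ∷ ax-m2 ∷ ⊗-rule ∷ ⊸-rule ∷ ax-e1 ∷ ax-e2 ∷ bang-der ∷ weak ∷ []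
rulesOf ms¬⊸ = ax-m1 ∷ ax-m2 ∷ ⊗-rule ∷ ax-e1 ∷ ax-e2 ∷ bang-der ∷ weak ∷ []
rulesOf ss¬⊸ = ax-m1 ∷ ax-m2 ∷ ⊗-rule ∷ ess ∷ []

data Step (a : System) {Γ Δ : Scope} (g : Grow Γ Δ) : Tm Γ → Tm Δ → Set where
  step : ∀ {Θ r u u'} → r ∈ rulesOf a → (C : Ctx gen Γ Θ) →
    Root r (liftGrow Θ g) u u' →
    Step a g (plug C u) (plug (renC (growRen g) C) u')

Term : Set
Term = Σ Scope Tm

_⟶[_]_ : Term → System → Term → Set
(Γ , t) ⟶[ a ] (Δ , t') = Σ[ g ∈ Grow Γ Δ ] Step a g t t'

SN : System → Term → Set
SN a x = ¬ (Σ[ f ∈ (ℕ → Term) ] (f zero ≡ x × (∀ n → f n ⟶[ a ] f (suc n))))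

data Listed : System → Set where
  l-m     : Listed 𝗆
  l-ems   : Listed ems
  l-ess   : Listed ess-sys
  l-ms¬⊸  : Listed ms¬⊸
  l-ss¬⊸  : Listed ss¬⊸

-- For the multiplicative rules the plain size of a term strictly decreases.  The exponential
-- rules duplicate values, so for them we weigh every variable by an upper bound on the weight of
-- whatever can still be substituted for it: a cut variable weighs one more than the cut value, the
-- components of par(m,x.y.t) weigh as much as m, the variable of der(e,x.t) as much as e.  Every
-- rule then replaces a variable by something strictly lighter, so the weight of the term drops.
-- The only rule that fails is (⊸): it cuts v against the λ-bound variable, whose weight 0 bounds
-- nothing.  A variable that escapes a cut in (ax_m1) or (⊗) becomes free with weight 0, so
-- weighting all free variables by 0 turns the weight into a measure on terms.

module Submission where

open import Defs
open import Data.Empty using (⊥-elim)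
open import Data.List using ([]; _∷_)
open import Data.List.Membership.Propositional using (_∈_)
open import Data.List.Relation.Unary.All as All using (All; []; _∷_)
open import Data.List.Relation.Unary.Any using (here; there)
open import Data.Nat
open import Data.Nat.Induction using (<-wellFounded)
open import Data.Nat.Properties
open import Algebra.Properties.CommutativeSemigroup +-commutativeSemigroup using (xy∙z≈xz∙y)
open import Data.Nat.Tactic.RingSolver using (solve-∀)
open import Data.Product using (_,_; ∃-syntax)
open import Data.Sum using (inj₁; inj₂)
open import Data.Unit using (⊤; tt)
open import Function using (id; _∘_)
open import Induction.InfiniteDescent using (Descent; descent∧wf⇒empty)
open import Relation.Binary.Core using (_Preserves_⟶_)
open import Relation.Binary.PropositionalEquality
open import Relation.Nullary using (¬_)

IsIdentity : ∀ {Γ} → Ren Γ Γ → Set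
IsIdentity {Γ} r = ∀ {k} (x : Γ ∋ k) → r x ≡ x

lift-identity : ∀ {Γ k} {r : Ren Γ Γ} → IsIdentity r → IsIdentity (lift {k = k} r)
lift-identity r≗id vz = refl
lift-identity r≗id (vs x) = cong vs (r≗id x)

mutual
  renV-identity : ∀ {Γ k} {r : Ren Γ Γ} → IsIdentity r → (v : Val Γ k) → renV r v ≡ v
  renV-identity r≗id (var x) = cong var (r≗id x)
  renV-identity r≗id (pair t s) = cong₂ pair (renT-identity r≗id t) (renT-identity r≗id s)
  renV-identity r≗id (lam k t) = cong (lam k) (renT-identity (lift-identity r≗id) t)
  renV-identity r≗id (bang t) = cong bang (renT-identity r≗id t)

  renT-identity : ∀ {Γ} {r : Ren Γ Γ} → IsIdentity r → (t : Tm Γ) → renT r t ≡ t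
  renT-identity r≗id (val v) = cong val (renV-identity r≗id v)
  renT-identity r≗id (cut v k t)
    rewrite renV-identity r≗id v | renT-identity (lift-identity r≗id) t = refl
  renT-identity r≗id (par m k₁ k₂ t)
    rewrite r≗id m | renT-identity (lift-identity (lift-identity r≗id)) t = refl
  renT-identity r≗id (sub m v k t)
    rewrite r≗id m | renV-identity r≗id v | renT-identity (lift-identity r≗id) t = refl
  renT-identity r≗id (der e k t)
    rewrite r≗id e | renT-identity (lift-identity r≗id) t = refl

mutual
  renVC-identity : ∀ {c Γ Θ k} {r : Ren Γ Γ} → IsIdentity r → (V : VCtx c Γ Θ k) → renVC r V ≡ V
  renVC-identity r≗id (pairL C s) = cong₂ pairL (renC-identity r≗id C) (renT-identity r≗id s)
  renVC-identity r≗id (pairR s C) = cong₂ pairR (renT-identity r≗id s) (renC-identity r≗id C)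
  renVC-identity r≗id (lamC k C) = cong (lamC k) (renC-identity (lift-identity r≗id) C)
  renVC-identity r≗id (bangC C) = cong bangC (renC-identity r≗id C)

  renC-identity : ∀ {c Γ Θ} {r : Ren Γ Γ} → IsIdentity r → (C : Ctx c Γ Θ) → renC r C ≡ C
  renC-identity r≗id hole = refl
  renC-identity r≗id (valC V) = cong valC (renVC-identity r≗id V)
  renC-identity r≗id (cutH k s) = cong (cutH k) (renT-identity (lift-identity r≗id) s)
  renC-identity r≗id (cutV V k s)
    rewrite renVC-identity r≗id V | renT-identity (lift-identity r≗id) s = refl
  renC-identity r≗id (subH m k s)
    rewrite r≗id m | renT-identity (lift-identity r≗id) s = refl
  renC-identity r≗id (subV m V k s)
    rewrite r≗id m | renVC-identity r≗id V | renT-identity (lift-identity r≗id) s = refl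
  renC-identity r≗id (cutB v k C)
    rewrite renV-identity r≗id v | renC-identity (lift-identity r≗id) C = refl
  renC-identity r≗id (parB m k₁ k₂ C)
    rewrite r≗id m | renC-identity (lift-identity (lift-identity r≗id)) C = refl
  renC-identity r≗id (subB m v k C)
    rewrite r≗id m | renV-identity r≗id v | renC-identity (lift-identity r≗id) C = refl
  renC-identity r≗id (derB e k C)
    rewrite r≗id e | renC-identity (lift-identity r≗id) C = refl

liftR-cong : ∀ {Γ Δ} Θ {r₁ r₂ : Ren Γ Δ} → (∀ {k} (x : Γ ∋ k) → r₁ x ≡ r₂ x) →
             ∀ {k} (x : (Θ ⧺ Γ) ∋ k) → liftR Θ r₁ x ≡ liftR Θ r₂ x
liftR-cong [] r₁≗r₂ x = r₁≗r₂ x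
liftR-cong (k ∷ Θ) r₁≗r₂ x = liftR-cong Θ (λ { vz → refl ; (vs y) → cong vs (r₁≗r₂ y) }) x

liftR-identity : ∀ {Γ} Θ {r : Ren Γ Γ} → IsIdentity r → IsIdentity (liftR Θ r)
liftR-identity [] r≗id x = r≗id x
liftR-identity (k ∷ Θ) r≗id x = liftR-identity Θ (lift-identity r≗id) x

insShift-liftIns : ∀ {Γ Δ} Θ (g : Ins Γ Δ) {k} (x : (Θ ⧺ Γ) ∋ k) →
                   insShift (liftIns Θ g) x ≡ liftR Θ (insShift g) x
insShift-liftIns [] g x = refl
insShift-liftIns (k ∷ Θ) g x =
  trans (insShift-liftIns Θ (there g) x) (liftR-cong Θ (λ { vz → refl ; (vs y) → refl }) x)

insVar-liftIns : ∀ {Γ Δ} Θ (g : Ins Γ Δ) → insVar (liftIns Θ g) ≡ wkΘ Θ (insVar g)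
insVar-liftIns [] g = refl
insVar-liftIns (k ∷ Θ) g = insVar-liftIns Θ (there g)

growRen-liftGrow : ∀ {Γ Δ} Θ (g : Grow Γ Δ) {k} (x : (Θ ⧺ Γ) ∋ k) →
                   growRen (liftGrow Θ g) x ≡ liftR Θ (growRen g) x
growRen-liftGrow Θ same x = sym (liftR-identity Θ (λ _ → refl) x)
growRen-liftGrow Θ (grow g) x = insShift-liftIns Θ g x

plugL-decomp : ∀ {Γ} (u : Tm Γ) → plugL (Decomp.lctx (decomp u)) (val (Decomp.value (decomp u))) ≡ u
plugL-decomp (val v) = refl
plugL-decomp (cut v k t) with decomp t | plugL-decomp t
... | ⟨ L , w ⟩ | eq = cong (cut v k) eq
plugL-decomp (par m k₁ k₂ t) with decomp t | plugL-decomp t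
... | ⟨ L , w ⟩ | eq = cong (par m k₁ k₂) eq
plugL-decomp (sub m v k t) with decomp t | plugL-decomp t
... | ⟨ L , w ⟩ | eq = cong (sub m v k) eq
plugL-decomp (der e k t) with decomp t | plugL-decomp t
... | ⟨ L , w ⟩ | eq = cong (der e k) eq

no-infinite-descent : (μ : ℕ → ℕ) → ¬ (∀ n → μ (suc n) < μ n)
no-infinite-descent μ μ-descends =
  descent∧wf⇒empty descends <-wellFounded (μ 0) (0 , refl)
  where
    descends : Descent _<_ (λ m → ∃[ n ] μ n ≡ m)
    descends (n , refl) = μ (suc n) , μ-descends n , suc n , refl

SN-by-measure : ∀ a (μ : Term → ℕ) → (∀ {x y} → x ⟶[ a ] y → μ y < μ x) → ∀ x → SN a x
SN-by-measure a μ μ-decreases x (f , _ , steps) = no-infinite-descent (μ ∘ f) (μ-decreases ∘ steps)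

-- The multiplicative system: size

mutual
  sizeV : ∀ {Γ k} → Val Γ k → ℕ
  sizeV (var x) = 1
  sizeV (pair t s) = suc (size t + size s)
  sizeV (lam k t) = suc (size t)
  sizeV (bang t) = suc (size t)

  size : ∀ {Γ} → Tm Γ → ℕ
  size (val v) = sizeV v
  size (cut v k t) = suc (sizeV v + size t)
  size (par m k₁ k₂ t) = suc (size t)
  size (sub m v k t) = suc (sizeV v + size t)
  size (der e k t) = suc (size t)

mutual
  sizeV-renV : ∀ {Γ Δ k} (r : Ren Γ Δ) (v : Val Γ k) → sizeV (renV r v) ≡ sizeV v
  sizeV-renV r (var x) = refl
  sizeV-renV r (pair t s) = cong suc (cong₂ _+_ (size-renT r t) (size-renT r s))
  sizeV-renV r (lam k t) = cong suc (size-renT (lift r) t)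
  sizeV-renV r (bang t) = cong suc (size-renT r t)

  size-renT : ∀ {Γ Δ} (r : Ren Γ Δ) (t : Tm Γ) → size (renT r t) ≡ size t
  size-renT r (val v) = sizeV-renV r v
  size-renT r (cut v k t) = cong suc (cong₂ _+_ (sizeV-renV r v) (size-renT (lift r) t))
  size-renT r (par m k₁ k₂ t) = cong suc (size-renT (lift (lift r)) t)
  size-renT r (sub m v k t) = cong suc (cong₂ _+_ (sizeV-renV r v) (size-renT (lift r) t))
  size-renT r (der e k t) = cong suc (size-renT (lift r) t)

sizeL : ∀ {Γ Λ} → LCtx Γ Λ → ℕ
sizeL ∙ = 0
sizeL (cutL v k L) = suc (sizeV v + sizeL L)
sizeL (parL m k₁ k₂ L) = suc (sizeL L)
sizeL (subL m v k L) = suc (sizeV v + sizeL L)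
sizeL (derL e k L) = suc (sizeL L)

size-plugL : ∀ {Γ Λ} (L : LCtx Γ Λ) (w : Tm Λ) → size (plugL L w) ≡ sizeL L + size w
size-plugL ∙ w = refl
size-plugL (cutL v k L) w = cong suc (trans (cong (sizeV v +_) (size-plugL L w)) (sym (+-assoc (sizeV v) _ _)))
size-plugL (parL m k₁ k₂ L) w = cong suc (size-plugL L w)
size-plugL (subL m v k L) w = cong suc (trans (cong (sizeV v +_) (size-plugL L w)) (sym (+-assoc (sizeV v) _ _)))
size-plugL (derL e k L) w = cong suc (size-plugL L w)

size-cutUnder : ∀ {Γ} (u : Tm Γ) k (s : Tm (k ∷ Γ)) → size (cutUnder (decomp u) k s) ≡ size u + suc (size s)
size-cutUnder u k s with decomp u | plugL-decomp u
... | ⟨ L , v ⟩ | refl = begin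
  size (plugL L (cut v k s'))                ≡⟨ size-plugL L _ ⟩
  sizeL L + suc (sizeV v + size s')          ≡⟨ cong (λ n → sizeL L + suc (sizeV v + n)) (size-renT _ s) ⟩
  sizeL L + suc (sizeV v + size s)           ≡⟨ reassoc (sizeL L) (sizeV v) (size s) ⟩
  (sizeL L + sizeV v) + suc (size s)         ≡⟨ cong (_+ suc (size s)) (size-plugL L (val v)) ⟨
  size (plugL L (val v)) + suc (size s)      ∎
  where
    open ≡-Reasoning
    s' = renT (lift (lwk L)) s
    reassoc : ∀ a b c → a + suc (b + c) ≡ (a + b) + suc c
    reassoc = solve-∀

size-subUnder : ∀ {Γ} m (u : Tm Γ) k (s : Tm (k ∷ Γ)) → size (subUnder m (decomp u) k s) ≡ size u + suc (size s)
size-subUnder m u k s with decomp u | plugL-decomp u | size-cutUnder u k s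
... | ⟨ L , v ⟩ | refl | size-cut = trans (size-plugL L _) (trans (sym (size-plugL L _)) size-cut)

mutual
  sizeVC : ∀ {c Γ Θ k} → VCtx c Γ Θ k → ℕ
  sizeVC (pairL C s) = suc (sizeC C + size s)
  sizeVC (pairR s C) = suc (size s + sizeC C)
  sizeVC (lamC k C) = suc (sizeC C)
  sizeVC (bangC C) = suc (sizeC C)

  sizeC : ∀ {c Γ Θ} → Ctx c Γ Θ → ℕ
  sizeC hole = 0
  sizeC (valC V) = sizeVC V
  sizeC (cutH k s) = suc (size s)
  sizeC (cutV V k s) = suc (sizeVC V + size s)
  sizeC (subH m k s) = suc (size s)
  sizeC (subV m V k s) = suc (sizeVC V + size s)
  sizeC (cutB v k C) = suc (sizeV v + sizeC C)
  sizeC (parB m k₁ k₂ C) = suc (sizeC C)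
  sizeC (subB m v k C) = suc (sizeV v + sizeC C)
  sizeC (derB e k C) = suc (sizeC C)

mutual
  sizeVC-renVC : ∀ {c Γ Δ Θ k} (r : Ren Γ Δ) (V : VCtx c Γ Θ k) → sizeVC (renVC r V) ≡ sizeVC V
  sizeVC-renVC r (pairL C s) = cong suc (cong₂ _+_ (sizeC-renC r C) (size-renT r s))
  sizeVC-renVC r (pairR s C) = cong suc (cong₂ _+_ (size-renT r s) (sizeC-renC r C))
  sizeVC-renVC r (lamC k C) = cong suc (sizeC-renC (lift r) C)
  sizeVC-renVC r (bangC C) = cong suc (sizeC-renC r C)

  sizeC-renC : ∀ {c Γ Δ Θ} (r : Ren Γ Δ) (C : Ctx c Γ Θ) → sizeC (renC r C) ≡ sizeC C
  sizeC-renC r hole = refl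
  sizeC-renC r (valC V) = sizeVC-renVC r V
  sizeC-renC r (cutH k s) = cong suc (size-renT (lift r) s)
  sizeC-renC r (cutV V k s) = cong suc (cong₂ _+_ (sizeVC-renVC r V) (size-renT (lift r) s))
  sizeC-renC r (subH m k s) = cong suc (size-renT (lift r) s)
  sizeC-renC r (subV m V k s) = cong suc (cong₂ _+_ (sizeVC-renVC r V) (size-renT (lift r) s))
  sizeC-renC r (cutB v k C) = cong suc (cong₂ _+_ (sizeV-renV r v) (sizeC-renC (lift r) C))
  sizeC-renC r (parB m k₁ k₂ C) = cong suc (sizeC-renC (lift (lift r)) C)
  sizeC-renC r (subB m v k C) = cong suc (cong₂ _+_ (sizeV-renV r v) (sizeC-renC (lift r) C))
  sizeC-renC r (derB e k C) = cong suc (sizeC-renC (lift r) C)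

mutual
  sizeV-plugV : ∀ {c Γ Θ k} (V : VCtx c Γ Θ k) u → sizeV (plugV V u) ≡ sizeVC V + size u
  sizeV-plugV (pairL C s) u = cong suc (trans (cong (_+ size s) (size-plug C u)) (xy∙z≈xz∙y (sizeC C) (size u) (size s)))
  sizeV-plugV (pairR s C) u = cong suc (trans (cong (size s +_) (size-plug C u)) (sym (+-assoc (size s) _ _)))
  sizeV-plugV (lamC k C) u = cong suc (size-plug C u)
  sizeV-plugV (bangC C) u = cong suc (size-plug C u)

  size-plug : ∀ {c Γ Θ} (C : Ctx c Γ Θ) u → size (plug C u) ≡ sizeC C + size u
  size-plug hole u = refl
  size-plug (valC V) u = sizeV-plugV V u
  size-plug (cutH k s) u = trans (size-cutUnder u k s) (+-comm (size u) _)
  size-plug (cutV V k s) u = cong suc (trans (cong (_+ size s) (sizeV-plugV V u)) (xy∙z≈xz∙y (sizeVC V) (size u) (size s)))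
  size-plug (subH m k s) u = trans (size-subUnder m u k s) (+-comm (size u) _)
  size-plug (subV m V k s) u = cong suc (trans (cong (_+ size s) (sizeV-plugV V u)) (xy∙z≈xz∙y (sizeVC V) (size u) (size s)))
  size-plug (cutB v k C) u = cong suc (trans (cong (sizeV v +_) (size-plug C u)) (sym (+-assoc (sizeV v) _ _)))
  size-plug (parB m k₁ k₂ C) u = cong suc (size-plug C u)
  size-plug (subB m v k C) u = cong suc (trans (cong (sizeV v +_) (size-plug C u)) (sym (+-assoc (sizeV v) _ _)))
  size-plug (derB e k C) u = cong suc (size-plug C u)

size-plug-renC : ∀ {c Γ Δ Θ} (r : Ren Γ Δ) (C : Ctx c Γ Θ) u → size (plug (renC r C) u) ≡ sizeC C + size u
size-plug-renC r C u = trans (size-plug (renC r C) u) (cong (_+ size u) (sizeC-renC r C))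

size-root-< : ∀ {r Γ Δ} {g : Grow Γ Δ} {u u'} → r ∈ rulesOf 𝗆 → Root r g u u' → size u' < size u
size-root-< (here refl) (r-ax-m1 {Θ = Θ} v M g) = begin-strict
  size (plug (renC (escape g) M) (val v'))   ≡⟨ size-plug-renC (escape g) M (val v') ⟩
  sizeC M + sizeV v'                         ≡⟨ cong (sizeC M +_) (trans (sizeV-renV _ _) (sizeV-renV _ v)) ⟩
  sizeC M + sizeV v                          <⟨ m<m+n _ z<s ⟩
  sizeC M + sizeV v + 2                      ≡⟨ arith (sizeC M) (sizeV v) ⟩
  suc (sizeV v + (sizeC M + 1))              ≡⟨ cong (λ n → suc (sizeV v + n)) (size-plug M _) ⟨
  size (cut v mul (plug M (val (var (wkΘ Θ vz))))) ∎
  where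
    open ≤-Reasoning
    v' = renV (wkΘ Θ) (renV (insShift g) v)
    arith : ∀ c w → c + w + 2 ≡ suc (w + (c + 1))
    arith = solve-∀
size-root-< (there (here refl)) (r-ax-m2 n t) =
  <-trans (≤-reflexive (cong suc (size-renT (single n) t))) (n<1+n _)
size-root-< (there (there (here refl))) (r-⊗ {Θ = Θ} s u M k₁ k₂ t g) = begin-strict
  size (plug (renC (escape g) M) contractum)  ≡⟨ size-plug-renC (escape g) M contractum ⟩
  sizeC M + size contractum                   ≡⟨ cong (sizeC M +_) contractum-size ⟩
  sizeC M + (size s + suc (size u + suc (size t)))                <⟨ n<1+n _ ⟩
  suc (sizeC M + (size s + suc (size u + suc (size t))))          ≡⟨ arith (sizeC M) (size s) (size u) (size t) ⟩
  suc (suc (size s + size u) + (sizeC M + suc (size t)))          ≡⟨ cong (λ n → suc (suc (size s + size u) + n)) (size-plug M _) ⟨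
  size (cut (pair s u) mul (plug M (par (wkΘ Θ vz) k₁ k₂ t)))     ∎
  where
    open ≤-Reasoning
    s' = renT (wkΘ Θ) (renT (insShift g) s)
    u' = renT vs (renT (wkΘ Θ) (renT (insShift g) u))
    t' = renT (lift (lift (liftR Θ (escape g)))) t
    contractum = cutUnder (decomp s') k₁ (cutUnder (decomp u') k₂ t')
    contractum-size : size contractum ≡ size s + suc (size u + suc (size t))
    contractum-size = begin-equality
      size contractum                                 ≡⟨ size-cutUnder s' k₁ _ ⟩
      size s' + suc (size (cutUnder (decomp u') k₂ t')) ≡⟨ cong (λ n → size s' + suc n) (size-cutUnder u' k₂ t') ⟩
      size s' + suc (size u' + suc (size t'))         ≡⟨ cong₂ (λ a b → a + suc (b + suc (size t'))) s'-size u'-size ⟩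
      size s + suc (size u + suc (size t'))           ≡⟨ cong (λ n → size s + suc (size u + suc n)) (size-renT _ t) ⟩
      size s + suc (size u + suc (size t))            ∎
      where
        s'-size = trans (size-renT (wkΘ Θ) (renT (insShift g) s)) (size-renT (insShift g) s)
        u'-size = trans (size-renT vs (renT (wkΘ Θ) (renT (insShift g) u)))
                 (trans (size-renT (wkΘ Θ) (renT (insShift g) u)) (size-renT (insShift g) u))
    arith : ∀ c a b d → suc (c + (a + suc (b + suc d))) ≡ suc (suc (a + b) + (c + suc d))
    arith = solve-∀
size-root-< (there (there (there (here refl)))) (r-⊸ {Θ = Θ} s M v k' t g) = begin-strict
  size (plug (renC (escape g) M) contractum)  ≡⟨ size-plug-renC (escape g) M contractum ⟩
  sizeC M + size contractum                   ≡⟨ cong (sizeC M +_) contractum-size ⟩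
  sizeC M + suc (sizeV v + (size s + suc (size t)))           <⟨ n<1+n _ ⟩
  suc (sizeC M + suc (sizeV v + (size s + suc (size t))))     ≡⟨ arith (sizeC M) (sizeV v) (size s) (size t) ⟩
  suc (suc (size s) + (sizeC M + suc (sizeV v + size t)))     ≡⟨ cong (λ n → suc (suc (size s) + n)) (size-plug M _) ⟨
  size (cut (lam _ s) mul (plug M (sub (wkΘ Θ vz) v k' t)))  ∎
  where
    open ≤-Reasoning
    v' = renV (liftR Θ (escape g)) v
    s' = renT (lift (wkΘ Θ)) (renT (lift (insShift g)) s)
    t' = renT (lift (λ x → vs (liftR Θ (escape g) x))) t
    contractum = cut v' _ (cutUnder (decomp s') k' t')
    contractum-size : size contractum ≡ suc (sizeV v + (size s + suc (size t)))
    contractum-size = cong₂ (λ a b → suc (a + b)) (sizeV-renV _ v)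
      (trans (size-cutUnder s' k' t')
             (cong₂ (λ a b → a + suc b)
                    (trans (size-renT (lift (wkΘ Θ)) (renT (lift (insShift g)) s)) (size-renT (lift (insShift g)) s))
                                        (size-renT _ t)))
    arith : ∀ c w a d → suc (c + suc (w + (a + suc d))) ≡ suc (suc a + (c + suc (w + d)))
    arith = solve-∀

size-step-< : ∀ {Γ Δ} {g : Grow Γ Δ} {t t'} → Step 𝗆 g t t' → size t' < size t
size-step-< {g = g} (step {u = u} {u'} r∈𝗆 C root) = begin-strict
  size (plug (renC (growRen g) C) u')  ≡⟨ size-plug-renC (growRen g) C u' ⟩
  sizeC C + size u'                    <⟨ +-monoʳ-< (sizeC C) (size-root-< r∈𝗆 root) ⟩
  sizeC C + size u                     ≡⟨ size-plug C u ⟨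
  size (plug C u)                      ∎
  where open ≤-Reasoning

SN-𝗆 : ∀ x → SN 𝗆 x
SN-𝗆 = SN-by-measure 𝗆 (λ (_ , t) → size t) (λ (_ , t⟶t') → size-step-< t⟶t')

-- The ⊸-free systems: weight

Weights : Scope → Set
Weights Γ = ∀ {k} → Γ ∋ k → ℕ

extend : ∀ {Γ k} → Weights Γ → ℕ → Weights (k ∷ Γ)
extend ρ c vz = c
extend ρ c (vs x) = ρ x

-- The continuation κ receives the weight of the final value v of t = L⟨v⟩: a context
-- cut(□,x.s) reattaches s there, under L.
mutual
  weightV : ∀ {Γ k} → Val Γ k → Weights Γ → ℕ
  weightV (var x) ρ = ρ x
  weightV (pair t s) ρ = suc (weight t ρ id + weight s ρ id)
  weightV (lam k t) ρ = suc (weight t (extend ρ 0) id)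
  weightV (bang t) ρ = suc (weight t ρ id)

  weight : ∀ {Γ} → Tm Γ → Weights Γ → (ℕ → ℕ) → ℕ
  weight (val v) ρ κ = κ (weightV v ρ)
  weight (cut v k t) ρ κ = suc (weightV v ρ + weight t (extend ρ (suc (weightV v ρ))) κ)
  weight (par m k₁ k₂ t) ρ κ = suc (ρ m + weight t (extend (extend ρ (ρ m)) (ρ m)) κ)
  weight (sub m v k t) ρ κ = suc (weightV v ρ + weight t (extend ρ 0) κ)
  weight (der e k t) ρ κ = suc (ρ e + weight t (extend ρ (ρ e)) κ)

_≤ʷ_ : ∀ {Γ} → Weights Γ → Weights Γ → Set
_≤ʷ_ {Γ} ρ₁ ρ₂ = ∀ {k} (x : Γ ∋ k) → ρ₁ x ≤ ρ₂ x

RenPreserves : ∀ {Γ Δ} → Ren Γ Δ → Weights Γ → Weights Δ → Set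
RenPreserves {Γ} r ρ ρ' = ∀ {k} (x : Γ ∋ k) → ρ' (r x) ≡ ρ x

RenLowers : ∀ {Γ Δ} → Ren Γ Δ → Weights Γ → Weights Δ → Set
RenLowers {Γ} r ρ ρ' = ∀ {k} (x : Γ ∋ k) → ρ' (r x) ≤ ρ x

extend-≤ʷ : ∀ {Γ k} {ρ₁ ρ₂ : Weights Γ} {c₁ c₂} → c₁ ≤ c₂ → ρ₁ ≤ʷ ρ₂ →
            extend {k = k} ρ₁ c₁ ≤ʷ extend ρ₂ c₂
extend-≤ʷ c₁≤c₂ ρ₁≤ρ₂ vz = c₁≤c₂
extend-≤ʷ c₁≤c₂ ρ₁≤ρ₂ (vs x) = ρ₁≤ρ₂ x

lift-preserves : ∀ {Γ Δ k} {r : Ren Γ Δ} {ρ : Weights Γ} {ρ' : Weights Δ} {c c'} → c' ≡ c → RenPreserves r ρ ρ' →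
                 RenPreserves (lift {k = k} r) (extend ρ c) (extend ρ' c')
lift-preserves c'≡c r-pres vz = c'≡c
lift-preserves c'≡c r-pres (vs x) = r-pres x

lift-lowers : ∀ {Γ Δ k} {r : Ren Γ Δ} {ρ : Weights Γ} {ρ' : Weights Δ} {c c'} → c' ≤ c → RenLowers r ρ ρ' →
              RenLowers (lift {k = k} r) (extend ρ c) (extend ρ' c')
lift-lowers c'≤c r-low vz = c'≤c
lift-lowers c'≤c r-low (vs x) = r-low x

liftR-identity-lowers : ∀ {Γ} Θ {ρ ρ' : Weights (Θ ⧺ Γ)} → RenLowers (liftR Θ (λ x → x)) ρ ρ' → ρ' ≤ʷ ρ
liftR-identity-lowers Θ {ρ} {ρ'} low x = subst (λ y → ρ' y ≤ ρ x) (liftR-identity Θ (λ _ → refl) x) (low x)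

Monotone StrictlyMonotone : (ℕ → ℕ) → Set
Monotone κ = κ Preserves _≤_ ⟶ _≤_
StrictlyMonotone κ = κ Preserves _<_ ⟶ _<_

strictlyMonotone⇒monotone : ∀ {κ} → StrictlyMonotone κ → Monotone κ
strictlyMonotone⇒monotone κ-strict m≤n with m≤n⇒m<n∨m≡n m≤n
... | inj₁ m<n = <⇒≤ (κ-strict m<n)
... | inj₂ refl = ≤-refl

suc-+-strictlyMonotone : ∀ {f} → Monotone f → StrictlyMonotone (λ c → suc (c + f c))
suc-+-strictlyMonotone f-mono m<n = s≤s (+-mono-<-≤ m<n (f-mono (<⇒≤ m<n)))

mutual
  weightV-renV : ∀ {Γ Δ k} (r : Ren Γ Δ) {ρ : Weights Γ} {ρ' : Weights Δ} → RenPreserves r ρ ρ' → (v : Val Γ k) →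
                 weightV (renV r v) ρ' ≡ weightV v ρ
  weightV-renV r r-pres (var x) = r-pres x
  weightV-renV r r-pres (pair t s) = cong suc (cong₂ _+_ (weight-renT r r-pres t id) (weight-renT r r-pres s id))
  weightV-renV r r-pres (lam k t) = cong suc (weight-renT (lift r) (lift-preserves refl r-pres) t id)
  weightV-renV r r-pres (bang t) = cong suc (weight-renT r r-pres t id)

  weight-renT : ∀ {Γ Δ} (r : Ren Γ Δ) {ρ : Weights Γ} {ρ' : Weights Δ} → RenPreserves r ρ ρ' → (t : Tm Γ) → ∀ κ →
                weight (renT r t) ρ' κ ≡ weight t ρ κ
  weight-renT r r-pres (val v) κ = cong κ (weightV-renV r r-pres v)
  weight-renT r r-pres (cut v k t) κ =
    cong suc (cong₂ _+_ v-eq (weight-renT (lift r) (lift-preserves (cong suc v-eq) r-pres) t κ))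
    where v-eq = weightV-renV r r-pres v
  weight-renT r r-pres (par m k₁ k₂ t) κ =
    cong suc (cong₂ _+_ (r-pres m) (weight-renT (lift (lift r)) (lift-preserves (r-pres m) (lift-preserves (r-pres m) r-pres)) t κ))
  weight-renT r r-pres (sub m v k t) κ =
    cong suc (cong₂ _+_ (weightV-renV r r-pres v) (weight-renT (lift r) (lift-preserves refl r-pres) t κ))
  weight-renT r r-pres (der e k t) κ =
    cong suc (cong₂ _+_ (r-pres e) (weight-renT (lift r) (lift-preserves (r-pres e) r-pres) t κ))

mutual
  weightV-mono : ∀ {Γ k} {ρ₁ ρ₂ : Weights Γ} → ρ₁ ≤ʷ ρ₂ → (v : Val Γ k) → weightV v ρ₁ ≤ weightV v ρ₂
  weightV-mono ρ₁≤ρ₂ (var x) = ρ₁≤ρ₂ x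
  weightV-mono ρ₁≤ρ₂ (pair t s) = s≤s (+-mono-≤ (weight-mono ρ₁≤ρ₂ t id) (weight-mono ρ₁≤ρ₂ s id))
  weightV-mono ρ₁≤ρ₂ (lam k t) = s≤s (weight-mono (extend-≤ʷ ≤-refl ρ₁≤ρ₂) t id)
  weightV-mono ρ₁≤ρ₂ (bang t) = s≤s (weight-mono ρ₁≤ρ₂ t id)

  weight-mono : ∀ {Γ} {ρ₁ ρ₂ : Weights Γ} → ρ₁ ≤ʷ ρ₂ → (t : Tm Γ) → ∀ {κ} → Monotone κ →
                weight t ρ₁ κ ≤ weight t ρ₂ κ
  weight-mono ρ₁≤ρ₂ (val v) κ-mono = κ-mono (weightV-mono ρ₁≤ρ₂ v)
  weight-mono ρ₁≤ρ₂ (cut v k t) κ-mono = s≤s (+-mono-≤ v≤ (weight-mono (extend-≤ʷ (s≤s v≤) ρ₁≤ρ₂) t κ-mono))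
    where v≤ = weightV-mono ρ₁≤ρ₂ v
  weight-mono ρ₁≤ρ₂ (par m k₁ k₂ t) κ-mono =
    s≤s (+-mono-≤ (ρ₁≤ρ₂ m) (weight-mono (extend-≤ʷ (ρ₁≤ρ₂ m) (extend-≤ʷ (ρ₁≤ρ₂ m) ρ₁≤ρ₂)) t κ-mono))
  weight-mono ρ₁≤ρ₂ (sub m v k t) κ-mono =
    s≤s (+-mono-≤ (weightV-mono ρ₁≤ρ₂ v) (weight-mono (extend-≤ʷ ≤-refl ρ₁≤ρ₂) t κ-mono))
  weight-mono ρ₁≤ρ₂ (der e k t) κ-mono =
    s≤s (+-mono-≤ (ρ₁≤ρ₂ e) (weight-mono (extend-≤ʷ (ρ₁≤ρ₂ e) ρ₁≤ρ₂) t κ-mono))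

weightV-renV-≤ : ∀ {Γ Δ k} (r : Ren Γ Δ) {ρ : Weights Γ} {ρ' : Weights Δ} → RenLowers r ρ ρ' →
                 (v : Val Γ k) → weightV (renV r v) ρ' ≤ weightV v ρ
weightV-renV-≤ r {ρ' = ρ'} r-low v =
  ≤-trans (≤-reflexive (weightV-renV r {ρ = λ x → ρ' (r x)} (λ _ → refl) v)) (weightV-mono r-low v)

weight-renT-≤ : ∀ {Γ Δ} (r : Ren Γ Δ) {ρ : Weights Γ} {ρ' : Weights Δ} → RenLowers r ρ ρ' →
                (t : Tm Γ) → ∀ {κ} → Monotone κ →
                weight (renT r t) ρ' κ ≤ weight t ρ κ
weight-renT-≤ r {ρ' = ρ'} r-low t κ-mono =
  ≤-trans (≤-reflexive (weight-renT r {ρ = λ x → ρ' (r x)} (λ _ → refl) t _)) (weight-mono r-low t κ-mono)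

extendL : ∀ {Γ Λ} → LCtx Γ Λ → Weights Γ → Weights Λ
extendL ∙ ρ = ρ
extendL (cutL v k L) ρ = extendL L (extend ρ (suc (weightV v ρ)))
extendL (parL m k₁ k₂ L) ρ = extendL L (extend (extend ρ (ρ m)) (ρ m))
extendL (subL m v k L) ρ = extendL L (extend ρ 0)
extendL (derL e k L) ρ = extendL L (extend ρ (ρ e))

weightL : ∀ {Γ Λ} → LCtx Γ Λ → Weights Γ → ℕ
weightL ∙ ρ = 0
weightL (cutL v k L) ρ = suc (weightV v ρ + weightL L (extend ρ (suc (weightV v ρ))))
weightL (parL m k₁ k₂ L) ρ = suc (ρ m + weightL L (extend (extend ρ (ρ m)) (ρ m)))
weightL (subL m v k L) ρ = suc (weightV v ρ + weightL L (extend ρ 0))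
weightL (derL e k L) ρ = suc (ρ e + weightL L (extend ρ (ρ e)))

weight-plugL : ∀ {Γ Λ} (L : LCtx Γ Λ) (w : Tm Λ) (ρ : Weights Γ) κ →
               weight (plugL L w) ρ κ ≡ weightL L ρ + weight w (extendL L ρ) κ
weight-plugL ∙ w ρ κ = refl
weight-plugL (cutL v k L) w ρ κ = cong suc (trans (cong (weightV v ρ +_) (weight-plugL L w _ κ)) (sym (+-assoc (weightV v ρ) _ _)))
weight-plugL (parL m k₁ k₂ L) w ρ κ = cong suc (trans (cong (ρ m +_) (weight-plugL L w _ κ)) (sym (+-assoc (ρ m) _ _)))
weight-plugL (subL m v k L) w ρ κ = cong suc (trans (cong (weightV v ρ +_) (weight-plugL L w _ κ)) (sym (+-assoc (weightV v ρ) _ _)))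
weight-plugL (derL e k L) w ρ κ = cong suc (trans (cong (ρ e +_) (weight-plugL L w _ κ)) (sym (+-assoc (ρ e) _ _)))

extendL-lwk : ∀ {Γ Λ} (L : LCtx Γ Λ) (ρ : Weights Γ) → RenPreserves (lwk L) ρ (extendL L ρ)
extendL-lwk ∙ ρ x = refl
extendL-lwk (cutL v k L) ρ x = extendL-lwk L _ (vs x)
extendL-lwk (parL m k₁ k₂ L) ρ x = extendL-lwk L _ (vs (vs x))
extendL-lwk (subL m v k L) ρ x = extendL-lwk L _ (vs x)
extendL-lwk (derL e k L) ρ x = extendL-lwk L _ (vs x)

lastWeight : ∀ {Γ} → Decomp Γ → Weights Γ → ℕ
lastWeight ⟨ L , v ⟩ ρ = weightV v (extendL L ρ)

weight-decomp : ∀ {Γ} (u : Tm Γ) (ρ : Weights Γ) κ →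
                weight u ρ κ ≡ weightL (Decomp.lctx (decomp u)) ρ + κ (lastWeight (decomp u) ρ)
weight-decomp u ρ κ with decomp u | plugL-decomp u
... | ⟨ L , v ⟩ | refl = weight-plugL L (val v) ρ κ

lastWeight≤weight : ∀ {Γ} (u : Tm Γ) (ρ : Weights Γ) → lastWeight (decomp u) ρ ≤ weight u ρ id
lastWeight≤weight u ρ = ≤-trans (m≤n+m _ _) (≤-reflexive (sym (weight-decomp u ρ id)))

weight-mono-κ : ∀ {Γ} (u : Tm Γ) (ρ : Weights Γ) {κ₁ κ₂} → (∀ c → κ₁ c ≤ κ₂ c) →
                weight u ρ κ₁ ≤ weight u ρ κ₂
weight-mono-κ u ρ κ₁≤κ₂ = subst₂ _≤_ (sym (weight-decomp u ρ _)) (sym (weight-decomp u ρ _)) (+-monoʳ-≤ _ (κ₁≤κ₂ _))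

weight-cutUnder-κ : ∀ {Γ} (u : Tm Γ) k (s : Tm (k ∷ Γ)) (ρ : Weights Γ) κ →
  weight (cutUnder (decomp u) k s) ρ κ ≡ weight u ρ (λ c → suc (c + weight s (extend ρ (suc c)) κ))
weight-cutUnder-κ u k s ρ κ with decomp u | plugL-decomp u
... | ⟨ L , v ⟩ | refl = begin
  weight (plugL L (cut v k (renT (lift (lwk L)) s))) ρ κ            ≡⟨ weight-plugL L _ ρ κ ⟩
  weightL L ρ + suc (A + weight (renT (lift (lwk L)) s) (extend ρL (suc A)) κ)
    ≡⟨ cong (λ n → weightL L ρ + suc (A + n)) (weight-renT _ (lift-preserves refl (extendL-lwk L ρ)) s κ) ⟩
  weightL L ρ + suc (A + weight s (extend ρ (suc A)) κ)             ≡⟨ weight-plugL L (val v) ρ _ ⟨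
  weight (plugL L (val v)) ρ (λ c → suc (c + weight s (extend ρ (suc c)) κ)) ∎
  where
    open ≡-Reasoning
    ρL = extendL L ρ
    A = weightV v ρL

weight-subUnder-κ : ∀ {Γ} m (u : Tm Γ) k (s : Tm (k ∷ Γ)) (ρ : Weights Γ) κ →
  weight (subUnder m (decomp u) k s) ρ κ ≡ weight u ρ (λ c → suc (c + weight s (extend ρ 0) κ))
weight-subUnder-κ m u k s ρ κ with decomp u | plugL-decomp u
... | ⟨ L , v ⟩ | refl = begin
  weight (plugL L (sub (lwk L m) v k (renT (lift (lwk L)) s))) ρ κ  ≡⟨ weight-plugL L _ ρ κ ⟩
  weightL L ρ + suc (A + weight (renT (lift (lwk L)) s) (extend ρL 0) κ)
    ≡⟨ cong (λ n → weightL L ρ + suc (A + n)) (weight-renT _ (lift-preserves refl (extendL-lwk L ρ)) s κ) ⟩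
  weightL L ρ + suc (A + weight s (extend ρ 0) κ)                   ≡⟨ weight-plugL L (val v) ρ _ ⟨
  weight (plugL L (val v)) ρ (λ c → suc (c + weight s (extend ρ 0) κ)) ∎
  where
    open ≡-Reasoning
    ρL = extendL L ρ
    A = weightV v ρL

weight-cutUnder : ∀ {Γ} (u : Tm Γ) k (s : Tm (k ∷ Γ)) (ρ : Weights Γ) κ →
  weight (cutUnder (decomp u) k s) ρ κ ≡ suc (weight u ρ id + weight s (extend ρ (suc (lastWeight (decomp u) ρ))) κ)
weight-cutUnder u k s ρ κ = begin
  weight (cutUnder (decomp u) k s) ρ κ             ≡⟨ weight-cutUnder-κ u k s ρ κ ⟩
  weight u ρ (λ c → suc (c + weight s (extend ρ (suc c)) κ)) ≡⟨ weight-decomp u ρ _ ⟩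
  P + suc (A + S)                                  ≡⟨ reassoc P A S ⟩
  suc (P + A + S)                                  ≡⟨ cong (λ n → suc (n + S)) (weight-decomp u ρ id) ⟨
  suc (weight u ρ id + S)                          ∎
  where
    open ≡-Reasoning
    P = weightL (Decomp.lctx (decomp u)) ρ
    A = lastWeight (decomp u) ρ
    S = weight s (extend ρ (suc A)) κ
    reassoc : ∀ a b c → a + suc (b + c) ≡ suc (a + b + c)
    reassoc = solve-∀

-- Weight under contexts, substitution and the root rules

Shrinks : ∀ {Γ Δ} Θ → Ren Γ Δ → Weights Γ → Weights Δ → Tm (Θ ⧺ Γ) → Tm (Θ ⧺ Δ) → Set
Shrinks {Γ} {Δ} Θ r ρ ρ' u u' =
  ∀ {η : Weights (Θ ⧺ Γ)} {η' : Weights (Θ ⧺ Δ)} → RenLowers (liftR Θ r) η η' →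
  RenPreserves (wkΘ Θ) ρ η → RenPreserves (wkΘ Θ) ρ' η' →
  ∀ κ → StrictlyMonotone κ → weight u' η' κ < weight u η κ

shrinks-under : ∀ {Γ Δ k} Θ (r : Ren Γ Δ) {ρ : Weights Γ} {ρ' : Weights Δ} {c c'} u u' →
  Shrinks (k ∷ Θ) r ρ ρ' u u' → Shrinks Θ (lift r) (extend ρ c) (extend ρ' c') u u'
shrinks-under Θ r u u' shr {η} {η'} low pres pres' = shr {η} {η'} low (λ y → pres (vs y)) (λ y → pres' (vs y))

shrinks-under² : ∀ {Γ Δ k₁ k₂} Θ (r : Ren Γ Δ) {ρ : Weights Γ} {ρ' : Weights Δ} {c₁ c₁' c₂ c₂'} u u' →
  Shrinks (k₁ ∷ k₂ ∷ Θ) r ρ ρ' u u' →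
  Shrinks Θ (lift (lift r)) (extend (extend ρ c₁) c₂) (extend (extend ρ' c₁') c₂') u u'
shrinks-under² Θ r u u' shr {η} {η'} low pres pres' = shr {η} {η'} low (λ y → pres (vs (vs y))) (λ y → pres' (vs (vs y)))

mutual
  weightV-plugV-< : ∀ {c Γ Δ Θ k} (V : VCtx c Γ Θ k) (r : Ren Γ Δ) {ρ : Weights Γ} {ρ' : Weights Δ} →
    RenLowers r ρ ρ' → ∀ {u u'} → Shrinks Θ r ρ ρ' u u' → weightV (plugV (renVC r V) u') ρ' < weightV (plugV V u) ρ
  weightV-plugV-< (pairL C s) r low shr = s≤s (+-mono-<-≤ (weight-plug-< C r low shr id id) (weight-renT-≤ r low s id))
  weightV-plugV-< (pairR s C) r low shr = s≤s (+-mono-≤-< (weight-renT-≤ r low s id) (weight-plug-< C r low shr id id))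
  weightV-plugV-< (lamC {Θ = Θ} k C) r low {u} {u'} shr =
    s≤s (weight-plug-< C (lift r) (lift-lowers z≤n low) (shrinks-under Θ r u u' shr) id id)
  weightV-plugV-< (bangC C) r low shr = s≤s (weight-plug-< C r low shr id id)

  weight-plug-< : ∀ {c Γ Δ Θ} (C : Ctx c Γ Θ) (r : Ren Γ Δ) {ρ : Weights Γ} {ρ' : Weights Δ} →
    RenLowers r ρ ρ' → ∀ {u u'} → Shrinks Θ r ρ ρ' u u' →
    ∀ κ → StrictlyMonotone κ → weight (plug (renC r C) u') ρ' κ < weight (plug C u) ρ κ
  weight-plug-< hole r low shr κ κ-strict = shr low (λ _ → refl) (λ _ → refl) κ κ-strict
  weight-plug-< (valC V) r low shr κ κ-strict = κ-strict (weightV-plugV-< V r low shr)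
  weight-plug-< (cutH k s) r {ρ} {ρ'} low {u} {u'} shr κ κ-strict = begin-strict
    weight (cutUnder (decomp u') k s') ρ' κ                       ≡⟨ weight-cutUnder-κ u' k s' ρ' κ ⟩
    weight u' ρ' (λ c → suc (c + weight s' (extend ρ' (suc c)) κ))
      <⟨ shr low (λ _ → refl) (λ _ → refl) _ (suc-+-strictlyMonotone s'-mono) ⟩
    weight u ρ (λ c → suc (c + weight s' (extend ρ' (suc c)) κ))
      ≤⟨ weight-mono-κ u ρ (λ c → s≤s (+-monoʳ-≤ c (weight-renT-≤ (lift r) (lift-lowers ≤-refl low) s κ-mono))) ⟩
    weight u ρ (λ c → suc (c + weight s (extend ρ (suc c)) κ))     ≡⟨ weight-cutUnder-κ u k s ρ κ ⟨
    weight (cutUnder (decomp u) k s) ρ κ                           ∎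
    where
      open ≤-Reasoning
      κ-mono = strictlyMonotone⇒monotone κ-strict
      s' = renT (lift r) s
      s'-mono : Monotone (λ c → weight s' (extend ρ' (suc c)) κ)
      s'-mono c≤d = weight-mono (extend-≤ʷ (s≤s c≤d) (λ _ → ≤-refl)) s' κ-mono
  weight-plug-< (cutV V k s) r low shr κ κ-strict =
    s≤s (+-mono-<-≤ V< (weight-renT-≤ (lift r) (lift-lowers (<⇒≤ (s≤s V<)) low) s (strictlyMonotone⇒monotone κ-strict)))
    where V< = weightV-plugV-< V r low shr
  weight-plug-< (subH m k s) r {ρ} {ρ'} low {u} {u'} shr κ κ-strict = begin-strict
    weight (subUnder (r m) (decomp u') k s') ρ' κ         ≡⟨ weight-subUnder-κ (r m) u' k s' ρ' κ ⟩
    weight u' ρ' (λ c → suc (c + weight s' (extend ρ' 0) κ))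
      <⟨ shr low (λ _ → refl) (λ _ → refl) _ (suc-+-strictlyMonotone (λ _ → ≤-refl)) ⟩
    weight u ρ (λ c → suc (c + weight s' (extend ρ' 0) κ))
      ≤⟨ weight-mono-κ u ρ (λ c → s≤s (+-monoʳ-≤ c (weight-renT-≤ (lift r) (lift-lowers ≤-refl low) s κ-mono))) ⟩
    weight u ρ (λ c → suc (c + weight s (extend ρ 0) κ))     ≡⟨ weight-subUnder-κ m u k s ρ κ ⟨
    weight (subUnder m (decomp u) k s) ρ κ                   ∎
    where
      open ≤-Reasoning
      κ-mono = strictlyMonotone⇒monotone κ-strict
      s' = renT (lift r) s
  weight-plug-< (subV m V k s) r low shr κ κ-strict =
    s≤s (+-mono-<-≤ (weightV-plugV-< V r low shr) (weight-renT-≤ (lift r) (lift-lowers ≤-refl low) s (strictlyMonotone⇒monotone κ-strict)))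
  weight-plug-< (cutB {Θ = Θ} v k C) r low {u} {u'} shr κ κ-strict =
    s≤s (+-mono-≤-< v≤ (weight-plug-< C (lift r) (lift-lowers (s≤s v≤) low) (shrinks-under Θ r u u' shr) κ κ-strict))
    where v≤ = weightV-renV-≤ r low v
  weight-plug-< (parB {Θ = Θ} m k₁ k₂ C) r low {u} {u'} shr κ κ-strict =
    s≤s (+-mono-≤-< (low m) (weight-plug-< C (lift (lift r)) (lift-lowers (low m) (lift-lowers (low m) low)) (shrinks-under² Θ r u u' shr) κ κ-strict))
  weight-plug-< (subB {Θ = Θ} m v k C) r low {u} {u'} shr κ κ-strict =
    s≤s (+-mono-≤-< (weightV-renV-≤ r low v) (weight-plug-< C (lift r) (lift-lowers z≤n low) (shrinks-under Θ r u u' shr) κ κ-strict))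
  weight-plug-< (derB {Θ = Θ} e k C) r low {u} {u'} shr κ κ-strict =
    s≤s (+-mono-≤-< (low e) (weight-plug-< C (lift r) (lift-lowers (low e) low) (shrinks-under Θ r u u' shr) κ κ-strict))

weight-plug-identity-< : ∀ {c Γ Θ} (C : Ctx c Γ Θ) {ρ : Weights Γ} {u u'} → Shrinks Θ (λ x → x) ρ ρ u u' →
  ∀ κ → StrictlyMonotone κ → weight (plug C u') ρ κ < weight (plug C u) ρ κ
weight-plug-identity-< C {ρ} {u} {u'} shr κ κ-strict =
  subst (λ C' → weight (plug C' u') ρ κ < weight (plug C u) ρ κ) (renC-identity (λ _ → refl) C)
        (weight-plug-< C (λ x → x) (λ _ → ≤-refl) shr κ κ-strict)

imgWeight : ∀ {Δ k} → Img Δ k → Weights Δ → ℕ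
imgWeight {k = mul} x ρ = ρ x
imgWeight {k = exp} v ρ = weightV v ρ

imgWeight-imgVal : ∀ {Δ k} (i : Img Δ k) (ρ : Weights Δ) → weightV (imgVal i) ρ ≡ imgWeight i ρ
imgWeight-imgVal {k = mul} i ρ = refl
imgWeight-imgVal {k = exp} i ρ = refl

imgWeight-varImg : ∀ {Δ k} (x : Δ ∋ k) (ρ : Weights Δ) → imgWeight (varImg x) ρ ≡ ρ x
imgWeight-varImg {k = mul} x ρ = refl
imgWeight-varImg {k = exp} x ρ = refl

imgWeight-renImg : ∀ {Δ Δ' k} (r : Ren Δ Δ') {ρ : Weights Δ} {ρ' : Weights Δ'} → RenPreserves r ρ ρ' →
                   (i : Img Δ k) → imgWeight (renImg r i) ρ' ≡ imgWeight i ρ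
imgWeight-renImg {k = mul} r r-pres i = r-pres i
imgWeight-renImg {k = exp} r r-pres i = weightV-renV r r-pres i

SubLowers : ∀ {Γ Δ} → ESub Γ Δ → Weights Γ → Weights Δ → Set
SubLowers {Γ} σ ρ ρ' = ∀ {k} (x : Γ ∋ k) → imgWeight (σ x) ρ' ≤ ρ x

liftS-lowers : ∀ {Γ Δ k} {σ : ESub Γ Δ} {ρ : Weights Γ} {ρ' : Weights Δ} {c c'} → c' ≤ c →
               SubLowers σ ρ ρ' → SubLowers (liftS {k = k} σ) (extend ρ c) (extend ρ' c')
liftS-lowers {k = k} {ρ' = ρ'} {c' = c'} c'≤c σ-low vz = ≤-trans (≤-reflexive (imgWeight-varImg {k = k} vz (extend ρ' c'))) c'≤c
liftS-lowers {σ = σ} c'≤c σ-low (vs x) = ≤-trans (≤-reflexive (imgWeight-renImg vs (λ _ → refl) (σ x))) (σ-low x)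

mutual
  weightV-substV-≤ : ∀ {Γ Δ k} (σ : ESub Γ Δ) {ρ : Weights Γ} {ρ' : Weights Δ} → SubLowers σ ρ ρ' →
                     (v : Val Γ k) → weightV (substV σ v) ρ' ≤ weightV v ρ
  weightV-substV-≤ σ {ρ' = ρ'} σ-low (var x) = ≤-trans (≤-reflexive (imgWeight-imgVal (σ x) ρ')) (σ-low x)
  weightV-substV-≤ σ σ-low (pair t s) = s≤s (+-mono-≤ (weight-substT-≤ σ σ-low t id) (weight-substT-≤ σ σ-low s id))
  weightV-substV-≤ σ σ-low (lam k t) = s≤s (weight-substT-≤ (liftS σ) (liftS-lowers z≤n σ-low) t id)
  weightV-substV-≤ σ σ-low (bang t) = s≤s (weight-substT-≤ σ σ-low t id)

  weight-substT-≤ : ∀ {Γ Δ} (σ : ESub Γ Δ) {ρ : Weights Γ} {ρ' : Weights Δ} → SubLowers σ ρ ρ' →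
                    (t : Tm Γ) → ∀ {κ} → Monotone κ → weight (substT σ t) ρ' κ ≤ weight t ρ κ
  weight-substT-≤ σ σ-low (val v) κ-mono = κ-mono (weightV-substV-≤ σ σ-low v)
  weight-substT-≤ σ σ-low (cut v k t) κ-mono =
    s≤s (+-mono-≤ v≤ (weight-substT-≤ (liftS σ) (liftS-lowers (s≤s v≤) σ-low) t κ-mono))
    where v≤ = weightV-substV-≤ σ σ-low v
  weight-substT-≤ σ σ-low (par m k₁ k₂ t) κ-mono =
    s≤s (+-mono-≤ (σ-low m) (weight-substT-≤ (liftS (liftS σ)) (liftS-lowers (σ-low m) (liftS-lowers (σ-low m) σ-low)) t κ-mono))
  weight-substT-≤ σ σ-low (sub m v k t) κ-mono =
    s≤s (+-mono-≤ (weightV-substV-≤ σ σ-low v) (weight-substT-≤ (liftS σ) (liftS-lowers z≤n σ-low) t κ-mono))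
  weight-substT-≤ σ {ρ} {ρ'} σ-low (der e k t) {κ} κ-mono with σ e | σ-low e
  ... | var f | f≤e = s≤s (+-mono-≤ f≤e (weight-substT-≤ (liftS σ) (liftS-lowers f≤e σ-low) t κ-mono))
  -- {!L⟨v⟩/e}der(e,x.t) = L⟨cut(v,x.t')⟩, and the weight of e exceeds those of L and v together.
  ... | bang s | !s≤e with decomp s | plugL-decomp s
  ... | ⟨ L , v ⟩ | refl = begin
    weight (plugL L (cut v k t')) ρ' κ  ≡⟨ weight-plugL L _ ρ' κ ⟩
    P + suc (A + T')                    ≡⟨ reassoc P A T' ⟩
    suc (P + A + T')                    ≤⟨ s≤s (+-mono-≤ (<⇒≤ P+A<e) T'≤T) ⟩
    suc (ρ e + T)                       ∎
    where
      open ≤-Reasoning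
      P = weightL L ρ'
      A = weightV v (extendL L ρ')
      σL : ESub _ _
      σL x = renImg (lwk L) (σ x)
      t' = substT (liftS σL) t
      T = weight t (extend ρ (ρ e)) κ
      T' = weight t' (extend (extendL L ρ') (suc A)) κ
      P+A<e : P + A < ρ e
      P+A<e = subst (λ n → suc n ≤ ρ e) (weight-plugL L (val v) ρ' id) !s≤e
      σL-low : SubLowers σL ρ (extendL L ρ')
      σL-low x = ≤-trans (≤-reflexive (imgWeight-renImg (lwk L) (extendL-lwk L ρ') (σ x))) (σ-low x)
      T'≤T : T' ≤ T
      T'≤T = weight-substT-≤ (liftS σL) (liftS-lowers (≤-trans (s≤s (m≤n+m A P)) P+A<e) σL-low) t κ-mono
      reassoc : ∀ a b c → a + suc (b + c) ≡ suc (a + b + c)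
      reassoc = solve-∀

ax-e1-shrinks : ∀ {Γ} Θ (v : Val Γ exp) (ρ : Weights Γ) →
  let ρ₁ = extend {k = exp} ρ (suc (weightV v ρ)) in
  Shrinks Θ (λ x → x) ρ₁ ρ₁ (val (var (wkΘ Θ vz))) (val (renV (λ x → wkΘ Θ (vs x)) v))
ax-e1-shrinks Θ v ρ {η} {η'} _ pres pres' κ κ-strict = begin-strict
  κ (weightV (renV (λ x → wkΘ Θ (vs x)) v) η')  ≡⟨ cong κ (weightV-renV _ (λ x → pres' (vs x)) v) ⟩
  κ (weightV v ρ)                               <⟨ κ-strict (n<1+n _) ⟩
  κ (suc (weightV v ρ))                         ≡⟨ cong κ (pres vz) ⟨
  κ (η (wkΘ Θ vz))                              ∎
  where open ≤-Reasoning

ax-e2-shrinks : ∀ {Γ} Θ (f : Γ ∋ exp) k (t : Tm (k ∷ (Θ ⧺ (exp ∷ Γ)))) (ρ : Weights Γ) →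
  let ρ₁ = extend {k = exp} ρ (suc (ρ f)) in
  Shrinks Θ (λ x → x) ρ₁ ρ₁ (der (wkΘ Θ vz) k t) (der (wkΘ Θ (vs f)) k t)
ax-e2-shrinks Θ f k t ρ {η} {η'} low pres pres' κ κ-strict =
  s≤s (+-mono-<-≤ f<e (weight-mono (extend-≤ʷ (<⇒≤ f<e) (liftR-identity-lowers Θ low)) t (strictlyMonotone⇒monotone κ-strict)))
  where
    f<e : η' (wkΘ Θ (vs f)) < η (wkΘ Θ vz)
    f<e = subst₂ _<_ (sym (pres' (vs f))) (sym (pres vz)) (n<1+n _)

!der-shrinks : ∀ {Γ} Θ (s : Tm Γ) k (t : Tm (k ∷ (Θ ⧺ (exp ∷ Γ)))) (ρ : Weights Γ) →
  let ρ₁ = extend {k = exp} ρ (suc (suc (weight s ρ id))) in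
  Shrinks Θ (λ x → x) ρ₁ ρ₁ (der (wkΘ Θ vz) k t) (cutUnder (decomp (renT (λ x → wkΘ Θ (vs x)) s)) k t)
!der-shrinks Θ s k t ρ {η} {η'} low pres pres' κ κ-strict = begin-strict
  weight (cutUnder (decomp s') k t) η' κ                 ≡⟨ weight-cutUnder s' k t η' κ ⟩
  suc (weight s' η' id + weight t (extend η' (suc A)) κ) ≡⟨ cong (λ n → suc (n + weight t (extend η' (suc A)) κ)) s'-weight ⟩
  suc (S + weight t (extend η' (suc A)) κ)               ≤⟨ s≤s (+-monoʳ-≤ S t-weight) ⟩
  suc (S + T)                                            <⟨ n<1+n _ ⟩
  suc (suc S + T)                                        <⟨ n<1+n _ ⟩
  suc (suc (suc S) + T)                                  ≡⟨ cong (λ n → suc (n + T)) (pres vz) ⟨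
  suc (η (wkΘ Θ vz) + T)                                 ∎
  where
    open ≤-Reasoning
    S = weight s ρ id
    s' = renT (λ x → wkΘ Θ (vs x)) s
    A = lastWeight (decomp s') η'
    T = weight t (extend η (η (wkΘ Θ vz))) κ
    s'-weight : weight s' η' id ≡ S
    s'-weight = weight-renT _ (λ x → pres' (vs x)) s id
    A<e : suc A ≤ η (wkΘ Θ vz)
    A<e = subst (suc A ≤_) (sym (pres vz)) (s≤s (≤-trans (≤-trans (lastWeight≤weight s' η') (≤-reflexive s'-weight)) (n≤1+n S)))
    t-weight : weight t (extend η' (suc A)) κ ≤ T
    t-weight = weight-mono (extend-≤ʷ A<e (liftR-identity-lowers Θ low)) t (strictlyMonotone⇒monotone κ-strict)

weight-root-same-< : ∀ {r Γ} {u u' : Tm Γ} → Root r same u u' → (ρ : Weights Γ) →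
                     ∀ κ → StrictlyMonotone κ → weight u' ρ κ < weight u ρ κ
weight-root-same-< (r-ax-m2 n t) ρ κ κ-strict =
  s≤s (≤-trans (weight-renT-≤ (single n) n-low t (strictlyMonotone⇒monotone κ-strict)) (m≤n+m _ _))
  where
    n-low : RenLowers (single n) (extend ρ (suc (ρ n))) ρ
    n-low vz = n≤1+n _
    n-low (vs x) = ≤-refl
weight-root-same-< (r-w v t) ρ κ κ-strict =
  s≤s (≤-trans (≤-reflexive (sym (weight-renT vs (λ _ → refl) t κ))) (m≤n+m _ _))
weight-root-same-< (r-ess v t) ρ κ κ-strict =
  s≤s (≤-trans (weight-substT-≤ (essSub v) v-low t (strictlyMonotone⇒monotone κ-strict)) (m≤n+m _ _))
  where
    v-low : SubLowers (essSub v) (extend ρ (suc (weightV v ρ))) ρ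
    v-low vz = n≤1+n _
    v-low (vs x) = ≤-reflexive (imgWeight-varImg x ρ)
weight-root-same-< (r-ax-e1 {Θ = Θ} v C) ρ κ κ-strict =
  s≤s (+-monoʳ-< (weightV v ρ) (weight-plug-identity-< C (ax-e1-shrinks Θ v ρ) κ κ-strict))
weight-root-same-< (r-ax-e2 {Θ = Θ} f C k t) ρ κ κ-strict =
  s≤s (+-monoʳ-< (ρ f) (weight-plug-identity-< C (ax-e2-shrinks Θ f k t ρ) κ κ-strict))
weight-root-same-< (r-!der {Θ = Θ} s C k t) ρ κ κ-strict =
  s≤s (+-monoʳ-< (suc (weight s ρ id)) (weight-plug-identity-< C (!der-shrinks Θ s k t ρ) κ κ-strict))

Fresh : ∀ {Γ Δ} → Grow Γ Δ → Weights Δ → Set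
Fresh same ρ' = ⊤
Fresh (grow g) ρ' = ρ' (insVar g) ≡ 0

escape-lowers : ∀ {Γ Δ} (g : Ins Γ Δ) {ρ : Weights Γ} {ρ' : Weights Δ} {c} → ρ' (insVar g) ≡ 0 →
                RenLowers (insShift g) ρ ρ' → RenLowers (escape g) (extend ρ c) ρ'
escape-lowers g fresh low vz = ≤-trans (≤-reflexive fresh) z≤n
escape-lowers g fresh low (vs x) = low x

ax-m1-shrinks : ∀ {Γ Δ} Θ (v : Val Γ mul) (g : Ins Γ Δ) {ρ : Weights Γ} {ρ' : Weights Δ} →
  RenLowers (insShift g) ρ ρ' →
  Shrinks Θ (escape g) (extend ρ (suc (weightV v ρ))) ρ' (val (var (wkΘ Θ vz))) (val (renV (wkΘ Θ) (renV (insShift g) v)))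
ax-m1-shrinks Θ v g {ρ} {ρ'} low {η} {η'} _ pres pres' κ κ-strict = begin-strict
  κ (weightV (renV (wkΘ Θ) (renV (insShift g) v)) η') ≡⟨ cong κ (weightV-renV (wkΘ Θ) pres' (renV (insShift g) v)) ⟩
  κ (weightV (renV (insShift g) v) ρ')                 <⟨ κ-strict (s≤s (weightV-renV-≤ (insShift g) low v)) ⟩
  κ (suc (weightV v ρ))                                ≡⟨ cong κ (pres vz) ⟨
  κ (η (wkΘ Θ vz))                                     ∎
  where open ≤-Reasoning

⊗-shrinks : ∀ {Γ Δ} Θ (s u : Tm Γ) k₁ k₂ (t : Tm (k₂ ∷ k₁ ∷ (Θ ⧺ (mul ∷ Γ)))) (g : Ins Γ Δ)
  {ρ : Weights Γ} {ρ' : Weights Δ} → RenLowers (insShift g) ρ ρ' →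
  let s' = renT (wkΘ Θ) (renT (insShift g) s)
      u' = renT vs (renT (wkΘ Θ) (renT (insShift g) u))
      t' = renT (lift (lift (liftR Θ (escape g)))) t in
  Shrinks Θ (escape g) (extend ρ (suc (suc (weight s ρ id + weight u ρ id)))) ρ'
          (par (wkΘ Θ vz) k₁ k₂ t) (cutUnder (decomp s') k₁ (cutUnder (decomp u') k₂ t'))
⊗-shrinks Θ s u k₁ k₂ t g {ρ} {ρ'} low {η} {η'} low' pres pres' κ κ-strict = begin-strict
  weight (cutUnder (decomp s') k₁ (cutUnder (decomp u') k₂ t')) η' κ
    ≡⟨ weight-cutUnder s' k₁ _ η' κ ⟩
  suc (weight s' η' id + weight (cutUnder (decomp u') k₂ t') η₁ κ)
    ≡⟨ cong (λ n → suc (weight s' η' id + n)) (weight-cutUnder u' k₂ t' η₁ κ) ⟩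
  suc (weight s' η' id + suc (weight u' η₁ id + weight t' η₂ κ))
    ≤⟨ s≤s (+-mono-≤ s'≤S (s≤s (+-mono-≤ u'≤U t'≤T))) ⟩
  suc (S + suc (U + T))        ≡⟨ reassoc S U T ⟩
  suc (suc (S + U) + T)        <⟨ n<1+n _ ⟩
  suc (suc (suc (S + U)) + T)  ≡⟨ cong (λ n → suc (n + T)) (pres vz) ⟨
  suc (η (wkΘ Θ vz) + T)       ∎
  where
    open ≤-Reasoning
    S = weight s ρ id
    U = weight u ρ id
    s' = renT (wkΘ Θ) (renT (insShift g) s)
    u' = renT vs (renT (wkΘ Θ) (renT (insShift g) u))
    t' = renT (lift (lift (liftR Θ (escape g)))) t
    η₁ = extend η' (suc (lastWeight (decomp s') η'))
    η₂ = extend η₁ (suc (lastWeight (decomp u') η₁))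
    T = weight t (extend (extend η (η (wkΘ Θ vz))) (η (wkΘ Θ vz))) κ
    s'≤S : weight s' η' id ≤ S
    s'≤S = ≤-trans (≤-reflexive (weight-renT (wkΘ Θ) pres' (renT (insShift g) s) id)) (weight-renT-≤ (insShift g) low s id)
    u'≤U : weight u' η₁ id ≤ U
    u'≤U = ≤-trans (≤-reflexive (trans (weight-renT vs (λ _ → refl) (renT (wkΘ Θ) (renT (insShift g) u)) id)
                                       (weight-renT (wkΘ Θ) pres' (renT (insShift g) u) id)))
                   (weight-renT-≤ (insShift g) low u id)
    below-m : ∀ {n} → n ≤ S + U → suc n ≤ η (wkΘ Θ vz)
    below-m n≤ = subst (_ ≤_) (sym (pres vz)) (s≤s (≤-trans n≤ (n≤1+n _)))
    t'≤T : weight t' η₂ κ ≤ T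
    t'≤T = weight-renT-≤ _ (lift-lowers (below-m (≤-trans (lastWeight≤weight u' η₁) (≤-trans u'≤U (m≤n+m U S))))
                             (lift-lowers (below-m (≤-trans (lastWeight≤weight s' η') (≤-trans s'≤S (m≤m+n S U)))) low'))
                           t (strictlyMonotone⇒monotone κ-strict)
    reassoc : ∀ a b c → suc (a + suc (b + c)) ≡ suc (suc (a + b) + c)
    reassoc = solve-∀

weight-root-< : ∀ {r Γ Δ} {g : Grow Γ Δ} {u u'} → r ≢ ⊸-rule → Root r g u u' →
  ∀ {ρ : Weights Γ} {ρ' : Weights Δ} → RenLowers (growRen g) ρ ρ' → Fresh g ρ' →
  ∀ κ → StrictlyMonotone κ → weight u' ρ' κ < weight u ρ κ
weight-root-< {g = same} {u' = u'} _ root {ρ} low _ κ κ-strict =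
  ≤-<-trans (weight-mono low u' (strictlyMonotone⇒monotone κ-strict)) (weight-root-same-< root ρ κ κ-strict)
weight-root-< _ (r-ax-m1 {Θ = Θ} v M g) {ρ' = ρ'} low fresh κ κ-strict =
  <-≤-trans (weight-plug-< M (escape g) (escape-lowers g {ρ' = ρ'} fresh low) (ax-m1-shrinks Θ v g low) κ κ-strict)
            (≤-trans (m≤n+m _ _) (n≤1+n _))
weight-root-< _ (r-⊗ {Θ = Θ} s u M k₁ k₂ t g) {ρ' = ρ'} low fresh κ κ-strict =
  <-≤-trans (weight-plug-< M (escape g) (escape-lowers g {ρ' = ρ'} fresh low) (⊗-shrinks Θ s u k₁ k₂ t g low) κ κ-strict)
            (≤-trans (m≤n+m _ _) (n≤1+n _))
weight-root-< ⊸≢⊸ (r-⊸ s M v k' t g) = ⊥-elim (⊸≢⊸ refl)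

fresh-liftGrow : ∀ {Γ Δ} Θ (g : Grow Γ Δ) {ρ' : Weights Δ} {η' : Weights (Θ ⧺ Δ)} →
                 RenPreserves (wkΘ Θ) ρ' η' → Fresh g ρ' → Fresh (liftGrow Θ g) η'
fresh-liftGrow Θ same pres' fresh = tt
fresh-liftGrow Θ (grow g) {η' = η'} pres' fresh = trans (cong η' (insVar-liftIns Θ g)) (trans (pres' (insVar g)) fresh)

⊸-free : System → Set
⊸-free a = All (_≢ ⊸-rule) (rulesOf a)

weight-step-< : ∀ {a Γ Δ} {g : Grow Γ Δ} {t t'} → ⊸-free a → Step a g t t' →
  ∀ {ρ : Weights Γ} {ρ' : Weights Δ} → RenLowers (growRen g) ρ ρ' → Fresh g ρ' → weight t' ρ' id < weight t ρ id
weight-step-< {g = g} free (step {Θ} {u = u} {u'} r∈a C root) {ρ} {ρ'} low fresh =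
  weight-plug-< C (growRen g) low shr id id
  where
    shr : Shrinks Θ (growRen g) ρ ρ' u u'
    shr {η} {η'} low' _ pres' =
      weight-root-< (All.lookup free r∈a) root
        (λ x → subst (λ y → η' y ≤ η x) (sym (growRen-liftGrow Θ g x)) (low' x))
        (fresh-liftGrow Θ g pres' fresh)

fresh-zero : ∀ {Γ Δ} (g : Grow Γ Δ) → Fresh g (λ _ → 0)
fresh-zero same = tt
fresh-zero (grow g) = refl

SN-⊸-free : ∀ a → ⊸-free a → ∀ x → SN a x
SN-⊸-free a free = SN-by-measure a (λ (_ , t) → weight t (λ _ → 0) id)
  (λ (g , t⟶t') → weight-step-< free t⟶t' (λ _ → z≤n) (fresh-zero g))

theorem8p8 : (a : System) → Listed a → (Γ : Scope) (t : Tm Γ) → SN a (Γ , t)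
theorem8p8 .𝗆 l-m Γ t = SN-𝗆 (Γ , t)
theorem8p8 .ems l-ems Γ t = SN-⊸-free ems ((λ ()) ∷ (λ ()) ∷ (λ ()) ∷ (λ ()) ∷ []) (Γ , t)
theorem8p8 .ess-sys l-ess Γ t = SN-⊸-free ess-sys ((λ ()) ∷ []) (Γ , t)
theorem8p8 .ms¬⊸ l-ms¬⊸ Γ t =
  SN-⊸-free ms¬⊸ ((λ ()) ∷ (λ ()) ∷ (λ ()) ∷ (λ ()) ∷ (λ ()) ∷ (λ ()) ∷ (λ ()) ∷ []) (Γ , t)
theorem8p8 .ss¬⊸ l-ss¬⊸ Γ t = SN-⊸-free ss¬⊸ ((λ ()) ∷ (λ ()) ∷ (λ ()) ∷ (λ ()) ∷ []) (Γ , t)
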